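{- Let $B_s$ be the Bernoulli numbers ($B_0=1$, $B_s=-\frac{1}{s+1}\sum_{k=0}^{s-1}\binom{s+1}{k}B_k$ for $s\ge1$). Let $B^*_0=1$, $B^*_1=\frac14$, $B^*_s=-\frac{1}{s+1}\sum_{k=0}^{s-1}\binom{s+1}{k}2^{k-s}B_k$ for $s\ge2$, and let $B'_0=1$, $B'_s=-\frac{1}{s+1}\sum_{k=0}^{s-1}\binom{s+1}{k}2^{ -s}B_k$ for $s\ge1$. Define \[R_{2s+1}(z)=\sum_{k=0}^{s+1}\frac{B_{2k}B_{2s+2-2k}}{(2k)!(2s+2-2k)!}z^{2k},\qquad R_{2s}(z)=\sum_{k=0}^{s}\frac{B^*_{2s+1-2k}B^*_{2k}}{(2s+1-2k)!(2k)!}z^{2k}.\] Then for every integer $s\ge1$, \[R_{2s+1}(2)=R_{2s+1}(1)=-\frac{(2s+1)B_{2s+2}}{(2s+2)!},\qquad R_{2s}(1)=-\frac{B^*_{2s+1}}{(2s)!},\] \[R_{2s+1}\left(\tfrac12\right)=\frac{1}{2^{2s+2}}R_{2s+1}(1),\qquad R_{2s}\left(\tfrac12\right)=\sum_{k=0}^{s}\frac{B^*_{2s+1-2k}B'_{2k}}{(2s+1-2k)!(2k)!}=0,\] and, when $s$ is even, $R_{2s+1}(i)=0$ and $R_{2s}(i)=R_{2s}\left(\tfrac i2\right)$.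
   Context: $i=\sqrt{ -1}$. -}

module Defs where

open import Data.Nat as ℕ using (ℕ; zero; suc; _!)
open import Data.Nat.Properties using (_!≢0)
open import Data.Nat.Combinatorics using (_C_)
open import Data.Integer using (+_)
open import Data.Rational as ℚ using (ℚ; 0ℚ; 1ℚ; ½; _/_)
open import Data.Fin using (Fin; toℕ; fromℕ)
import Data.Fin
open import Data.Vec using (Vec; []; _∷_; _∷ʳ_; lookup)

ℕ→ℚ : ℕ → ℚ
ℕ→ℚ n = + n / 1

invFact : ℕ → ℚ
invFact n = _/_ (+ 1) (n !) {{n !≢0}}

invSuc : ℕ → ℚ
invSuc n = + 1 / suc n

qpow : ℚ → ℕ → ℚ
qpow q zero = 1ℚ
qpow q (suc m) = q ℚ.* qpow q m

twoNeg : ℕ → ℚ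
twoNeg m = qpow ½ m

-- sumTo n f = f 0 + f 1 + ... + f n
sumTo : {A : Set} → (A → A → A) → ℕ → (ℕ → A) → A
sumTo _⊕_ zero f = f zero
sumTo _⊕_ (suc n) f = sumTo _⊕_ n f ⊕ f (suc n)

sumBelow : ℕ → (ℕ → ℚ) → ℚ
sumBelow zero f = 0ℚ
sumBelow (suc n) f = sumTo ℚ._+_ n f

sumFin : (n : ℕ) → (Fin n → ℚ) → ℚ
sumFin zero f = 0ℚ
sumFin (suc n) f = f Data.Fin.zero ℚ.+ sumFin n (λ k → f (Data.Fin.suc k))

-- bernVec n = [B 0, ..., B n]
bernVec : (n : ℕ) → Vec ℚ (suc n)
bernVec zero = 1ℚ ∷ []
bernVec (suc n) = v ∷ʳ (ℚ.- invSuc (suc n) ℚ.* sumFin (suc n) (λ k → ℕ→ℚ (suc (suc n) C toℕ k) ℚ.* lookup v k))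
  where
  v : Vec ℚ (suc n)
  v = bernVec n

B : ℕ → ℚ
B s = lookup (bernVec s) (fromℕ s)

-- B* : B* 0 = 1, B* 1 = 1/4,
-- B* s = -1/(s+1) Σ_{k=0}^{s-1} C(s+1,k) 2^(k-s) B k   (s ≥ 2)
-- (for k < s, 2^(k-s) = 2^-(s-k))
B* : ℕ → ℚ
B* zero = 1ℚ
B* (suc zero) = + 1 / 4
B* s@(suc (suc _)) = ℚ.- invSuc s ℚ.* sumBelow s (λ k → ℕ→ℚ (suc s C k) ℚ.* twoNeg (s ℕ.∸ k) ℚ.* B k)

B′ : ℕ → ℚ
B′ zero = 1ℚ
B′ s@(suc _) = ℚ.- invSuc s ℚ.* sumBelow s (λ k → ℕ→ℚ (suc s C k) ℚ.* twoNeg s ℚ.* B k)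

-- Gaussian rationals ℚ(i), to evaluate R at i and i/2

record ℚi : Set where
  constructor _+i_
  field
    re im : ℚ

infixl 6 _⊕_
infixl 7 _⊗_

_⊕_ : ℚi → ℚi → ℚi
(a +i b) ⊕ (c +i d) = (a ℚ.+ c) +i (b ℚ.+ d)

_⊗_ : ℚi → ℚi → ℚi
(a +i b) ⊗ (c +i d) = (a ℚ.* c ℚ.- b ℚ.* d) +i (a ℚ.* d ℚ.+ b ℚ.* c)

ι : ℚ → ℚi
ι q = q +i 0ℚ

𝕚 : ℚi
𝕚 = 0ℚ +i 1ℚ

cpow : ℚi → ℕ → ℚi
cpow z zero = ι 1ℚ
cpow z (suc m) = z ⊗ cpow z m

Rodd : ℕ → ℚi → ℚi
Rodd s z = sumTo _⊕_ (suc s) (λ k →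
  ι (B (2 ℕ.* k) ℚ.* B (2 ℕ.* s ℕ.+ 2 ℕ.∸ 2 ℕ.* k)
     ℚ.* invFact (2 ℕ.* k) ℚ.* invFact (2 ℕ.* s ℕ.+ 2 ℕ.∸ 2 ℕ.* k))
  ⊗ cpow z (2 ℕ.* k))

Reven : ℕ → ℚi → ℚi
Reven s z = sumTo _⊕_ s (λ k →
  ι (B* (2 ℕ.* s ℕ.+ 1 ℕ.∸ 2 ℕ.* k) ℚ.* B* (2 ℕ.* k)
     ℚ.* invFact (2 ℕ.* s ℕ.+ 1 ℕ.∸ 2 ℕ.* k) ℚ.* invFact (2 ℕ.* k))
  ⊗ cpow z (2 ℕ.* k))

module Submission where

-- The identities are proved with generating functions, treating formal power
-- series over ℚ as coefficient sequences ℕ → ℚ with the Cauchy product.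
--
-- With β(t) = t/(eᵗ - 1) = Σ Bₙ tⁿ/n!, put E = β + t/2 = (t/2)·coth(t/2) and
-- O = 1 - 2β·(e^{t/2} - 1)/t.  The recursions defining B, B* and B′ say that
-- β·(eᵗ - 1)/t = 1, that B*ₙ/n! = Eₙ + Oₙ and that B′₂ₖ/(2k)! = 2^{-2k}·E₂ₖ.
-- From the first relation and e^{t/2}·e^{t/2} = eᵗ we derive that E is even,
-- O is odd, and the differential/functional equations
--   E² = E - θE + t²/4,        O·E = t/2 - θO,
--   E(2t)·E(t) = E(t)² + t²/4, O(2t)·E(t) = t/2,   E(2t) - E(t) = (t/2)·O(2t).
-- On the other hand R_{2s+1}(q) and R_{2s}(q) are the coefficients of t^{2s+2}
-- in E(qt)·E(t) and of t^{2s+1} in E(qt)·O(t), so reading off coefficients of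
-- the equations above gives the values at 1, 2 and 1/2.  At i, for even s, the
-- coefficients of R_{2s+1} pair off with opposite signs, and the last equation
-- (with t halved) makes R_{2s}(i) - R_{2s}(i/2) an antisymmetric sum.

open import Defs
open import Data.Nat as ℕ using (ℕ; zero; suc; _!; _∸_; _≤_; _<_; z≤n; s≤s)
import Data.Nat.Properties as ℕP
open import Data.Integer as ℤ using (ℤ; +_)
open import Data.Rational as ℚ using (ℚ; 0ℚ; 1ℚ; ½; _/_)
import Data.Rational.Properties as ℚP
open import Relation.Binary.PropositionalEquality

module Scalars where

  import Data.Rational.Unnormalised as ℚᵘ
  import Data.Rational.Unnormalised.Properties as ℚᵘP
  import Data.Integer.Properties as ℤP
  open import Data.Nat.Properties using (_!≢0)
  open import Data.Nat.Combinatorics using (_C_; nCk≡n!/k![n-k]!; k![n∸k]!∣n!)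
  import Data.Nat.DivMod as ℕD
  open import Data.Rational.Solver
  open +-*-Solver using (solve; _:+_; _:*_; :-_; _:=_; con)

  two ¼ neg1 : ℚ
  two = + 2 / 1
  ¼ = + 1 / 4
  neg1 = ℚ.- 1ℚ

  toℚᵘ-/ : ∀ i d → ℚᵘ._≃_ (ℚ.toℚᵘ (i / suc d)) (ℚᵘ.mkℚᵘ i d)
  toℚᵘ-/ i d = ℚP.toℚᵘ-fromℚᵘ (ℚᵘ.mkℚᵘ i d)

  ℕ→ℚ-+ : ∀ m n → ℕ→ℚ (m ℕ.+ n) ≡ ℕ→ℚ m ℚ.+ ℕ→ℚ n
  ℕ→ℚ-+ m n = ℚP.toℚᵘ-injective (ℚᵘP.≃-trans (toℚᵘ-/ (+ (m ℕ.+ n)) 0)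
    (ℚᵘP.≃-sym (ℚᵘP.≃-trans (ℚP.toℚᵘ-homo-+ (ℕ→ℚ m) (ℕ→ℚ n))
       (ℚᵘP.≃-trans (ℚᵘP.+-cong (toℚᵘ-/ (+ m) 0) (toℚᵘ-/ (+ n) 0)) (ℚᵘ.*≡* eq)))))
    where
    eq : (+ m ℤ.* + 1 ℤ.+ + n ℤ.* + 1) ℤ.* + 1 ≡ + (m ℕ.+ n) ℤ.* (+ 1 ℤ.* + 1)
    eq = begin
      (+ m ℤ.* + 1 ℤ.+ + n ℤ.* + 1) ℤ.* + 1 ≡⟨ ℤP.*-identityʳ _ ⟩
      + m ℤ.* + 1 ℤ.+ + n ℤ.* + 1 ≡⟨ cong₂ ℤ._+_ (ℤP.*-identityʳ (+ m)) (ℤP.*-identityʳ (+ n)) ⟩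
      + (m ℕ.+ n) ≡⟨ sym (ℤP.*-identityʳ _) ⟩
      + (m ℕ.+ n) ℤ.* (+ 1 ℤ.* + 1) ∎
      where open ≡-Reasoning

  ℕ→ℚ-* : ∀ m n → ℕ→ℚ (m ℕ.* n) ≡ ℕ→ℚ m ℚ.* ℕ→ℚ n
  ℕ→ℚ-* m n = ℚP.toℚᵘ-injective (ℚᵘP.≃-trans (toℚᵘ-/ (+ (m ℕ.* n)) 0)
    (ℚᵘP.≃-sym (ℚᵘP.≃-trans (ℚP.toℚᵘ-homo-* (ℕ→ℚ m) (ℕ→ℚ n))
       (ℚᵘP.≃-trans (ℚᵘP.*-cong (toℚᵘ-/ (+ m) 0) (toℚᵘ-/ (+ n) 0)) (ℚᵘ.*≡* eq)))))
    where
    eq : (+ m ℤ.* + n) ℤ.* + 1 ≡ + (m ℕ.* n) ℤ.* (+ 1 ℤ.* + 1)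
    eq = begin
      (+ m ℤ.* + n) ℤ.* + 1 ≡⟨ ℤP.*-identityʳ _ ⟩
      + m ℤ.* + n ≡⟨ ℤP.pos-* m n ⟨
      + (m ℕ.* n) ≡⟨ sym (ℤP.*-identityʳ _) ⟩
      + (m ℕ.* n) ℤ.* (+ 1 ℤ.* + 1) ∎
      where open ≡-Reasoning

  ℕ→ℚ-suc : ∀ n → ℕ→ℚ (suc n) ≡ ℕ→ℚ n ℚ.+ 1ℚ
  ℕ→ℚ-suc n = trans (cong ℕ→ℚ (ℕP.+-comm 1 n)) (ℕ→ℚ-+ n 1)

  *-recip : ∀ m .{{_ : ℕ.NonZero m}} → ℕ→ℚ m ℚ.* (+ 1 / m) ≡ 1ℚ
  *-recip (suc d) = ℚP.toℚᵘ-injective (ℚᵘP.≃-trans (ℚP.toℚᵘ-homo-* (ℕ→ℚ (suc d)) (+ 1 / suc d))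
     (ℚᵘP.≃-trans (ℚᵘP.*-cong (toℚᵘ-/ (+ suc d) 0) (toℚᵘ-/ (+ 1) d)) (ℚᵘ.*≡* eq)))
    where
    eq : (+ suc d ℤ.* + 1) ℤ.* + 1 ≡ + 1 ℤ.* (+ 1 ℤ.* + suc d)
    eq = begin
      (+ suc d ℤ.* + 1) ℤ.* + 1 ≡⟨ ℤP.*-identityʳ _ ⟩
      + suc d ℤ.* + 1 ≡⟨ ℤP.*-identityʳ _ ⟩
      + suc d ≡⟨ sym (ℤP.*-identityˡ _) ⟩
      + 1 ℤ.* + suc d ≡⟨ sym (ℤP.*-identityˡ _) ⟩
      + 1 ℤ.* (+ 1 ℤ.* + suc d) ∎
      where open ≡-Reasoning

  inverse-unique : ∀ a x y → a ℚ.* x ≡ 1ℚ → a ℚ.* y ≡ 1ℚ → x ≡ y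
  inverse-unique a x y p q = begin
    x ≡⟨ sym (ℚP.*-identityʳ x) ⟩
    x ℚ.* 1ℚ ≡⟨ cong (x ℚ.*_) (sym q) ⟩
    x ℚ.* (a ℚ.* y) ≡⟨ solve 3 (λ a x y → x :* (a :* y) := (a :* x) :* y) refl a x y ⟩
    (a ℚ.* x) ℚ.* y ≡⟨ cong (ℚ._* y) p ⟩
    1ℚ ℚ.* y ≡⟨ ℚP.*-identityˡ y ⟩
    y ∎
    where open ≡-Reasoning

  inverse-* : ∀ a b x y → a ℚ.* x ≡ 1ℚ → b ℚ.* y ≡ 1ℚ → (a ℚ.* b) ℚ.* (x ℚ.* y) ≡ 1ℚ
  inverse-* a b x y p q = begin
    (a ℚ.* b) ℚ.* (x ℚ.* y) ≡⟨ solve 4 (λ a b x y → (a :* b) :* (x :* y) := (a :* x) :* (b :* y)) refl a b x y ⟩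
    (a ℚ.* x) ℚ.* (b ℚ.* y) ≡⟨ cong₂ ℚ._*_ p q ⟩
    1ℚ ∎
    where open ≡-Reasoning

  solve-by-inverse : ∀ k k⁻¹ a b → k ℚ.* k⁻¹ ≡ 1ℚ → k ℚ.* a ≡ b → a ≡ k⁻¹ ℚ.* b
  solve-by-inverse k k⁻¹ a b p q = begin
    a ≡⟨ sym (ℚP.*-identityˡ a) ⟩
    1ℚ ℚ.* a ≡⟨ cong (ℚ._* a) (sym p) ⟩
    k ℚ.* k⁻¹ ℚ.* a ≡⟨ solve 3 (λ k k⁻¹ a → k :* k⁻¹ :* a := k⁻¹ :* (k :* a)) refl k k⁻¹ a ⟩
    k⁻¹ ℚ.* (k ℚ.* a) ≡⟨ cong (k⁻¹ ℚ.*_) q ⟩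
    k⁻¹ ℚ.* b ∎
    where open ≡-Reasoning

  zero-by-inverse : ∀ k k⁻¹ a → k ℚ.* k⁻¹ ≡ 1ℚ → a ℚ.* k ≡ 0ℚ → a ≡ 0ℚ
  zero-by-inverse k k⁻¹ a p q = trans (solve-by-inverse k k⁻¹ a 0ℚ p (trans (ℚP.*-comm k a) q)) (ℚP.*-zeroʳ k⁻¹)

  diff-zero-ℚ : ∀ a b → a ℚ.+ ℚ.- b ≡ 0ℚ → a ≡ b
  diff-zero-ℚ a b p = begin
    a ≡⟨ solve 2 (λ a b → a := (a :+ :- b) :+ b) refl a b ⟩
    (a ℚ.+ ℚ.- b) ℚ.+ b ≡⟨ cong (ℚ._+ b) p ⟩
    0ℚ ℚ.+ b ≡⟨ ℚP.+-identityˡ b ⟩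
    b ∎
    where open ≡-Reasoning

  fact*invFact : ∀ n → ℕ→ℚ (n !) ℚ.* invFact n ≡ 1ℚ
  fact*invFact n = *-recip (n !) {{n !≢0}}

  suc*invSuc : ∀ n → ℕ→ℚ (suc n) ℚ.* invSuc n ≡ 1ℚ
  suc*invSuc n = *-recip (suc n)

  invFact-suc : ∀ n → invFact (suc n) ≡ invSuc n ℚ.* invFact n
  invFact-suc n = inverse-unique (ℕ→ℚ (suc n !)) _ _ (fact*invFact (suc n))
    (subst (λ z → z ℚ.* (invSuc n ℚ.* invFact n) ≡ 1ℚ) (sym (ℕ→ℚ-* (suc n) (n !)))
       (inverse-* (ℕ→ℚ (suc n)) (ℕ→ℚ (n !)) (invSuc n) (invFact n) (suc*invSuc n) (fact*invFact n)))

  suc*invFact-suc : ∀ n → ℕ→ℚ (suc n) ℚ.* invFact (suc n) ≡ invFact n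
  suc*invFact-suc n = trans (cong (ℕ→ℚ (suc n) ℚ.*_) (invFact-suc n)) (trans (sym (ℚP.*-assoc (ℕ→ℚ (suc n)) (invSuc n) (invFact n)))
    (trans (cong (ℚ._* invFact n) (suc*invSuc n)) (ℚP.*-identityˡ (invFact n))))

  choose*invFact : ∀ n k → k ≤ n → ℕ→ℚ (n C k) ℚ.* invFact n ≡ invFact k ℚ.* invFact (n ∸ k)
  choose*invFact n k k≤n = inverse-unique (ℕ→ℚ (k ! ℕ.* (n ∸ k) !)) _ _ left right
    where
    instance _ = ℕP.m*n≢0 (k !) ((n ∸ k) !) {{k !≢0}} {{(n ∸ k) !≢0}}
    nat : (n C k) ℕ.* (k ! ℕ.* (n ∸ k) !) ≡ n !
    nat = trans (cong (ℕ._* (k ! ℕ.* (n ∸ k) !)) (nCk≡n!/k![n-k]! k≤n)) (ℕD.m/n*n≡m (k![n∸k]!∣n! k≤n))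
    left : ℕ→ℚ (k ! ℕ.* (n ∸ k) !) ℚ.* (ℕ→ℚ (n C k) ℚ.* invFact n) ≡ 1ℚ
    left = begin
      ℕ→ℚ (k ! ℕ.* (n ∸ k) !) ℚ.* (ℕ→ℚ (n C k) ℚ.* invFact n)
        ≡⟨ solve 3 (λ a b c → a :* (b :* c) := (b :* a) :* c) refl (ℕ→ℚ (k ! ℕ.* (n ∸ k) !)) (ℕ→ℚ (n C k)) (invFact n) ⟩
      (ℕ→ℚ (n C k) ℚ.* ℕ→ℚ (k ! ℕ.* (n ∸ k) !)) ℚ.* invFact n
        ≡⟨ cong (ℚ._* invFact n) (trans (sym (ℕ→ℚ-* (n C k) _)) (cong ℕ→ℚ nat)) ⟩
      ℕ→ℚ (n !) ℚ.* invFact n ≡⟨ fact*invFact n ⟩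
      1ℚ ∎
      where open ≡-Reasoning
    right : ℕ→ℚ (k ! ℕ.* (n ∸ k) !) ℚ.* (invFact k ℚ.* invFact (n ∸ k)) ≡ 1ℚ
    right = trans (cong (ℚ._* (invFact k ℚ.* invFact (n ∸ k))) (ℕ→ℚ-* (k !) ((n ∸ k) !)))
          (inverse-* (ℕ→ℚ (k !)) (ℕ→ℚ ((n ∸ k) !)) (invFact k) (invFact (n ∸ k)) (fact*invFact k) (fact*invFact (n ∸ k)))

  qpow-* : ∀ a b n → qpow a n ℚ.* qpow b n ≡ qpow (a ℚ.* b) n
  qpow-* a b zero = refl
  qpow-* a b (suc n) = trans (solve 4 (λ a b x y → (a :* x) :* (b :* y) := (a :* b) :* (x :* y)) refl a b (qpow a n) (qpow b n))
    (cong ((a ℚ.* b) ℚ.*_) (qpow-* a b n))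

  qpow-1 : ∀ n → qpow 1ℚ n ≡ 1ℚ
  qpow-1 zero = refl
  qpow-1 (suc n) = trans (ℚP.*-identityˡ (qpow 1ℚ n)) (qpow-1 n)

  qpow-+ : ∀ q a b → qpow q (a ℕ.+ b) ≡ qpow q a ℚ.* qpow q b
  qpow-+ q zero b = sym (ℚP.*-identityˡ (qpow q b))
  qpow-+ q (suc a) b = trans (cong (q ℚ.*_) (qpow-+ q a b)) (sym (ℚP.*-assoc q (qpow q a) (qpow q b)))

  qpow-double : ∀ q k → qpow q (2 ℕ.* k) ≡ qpow (q ℚ.* q) k
  qpow-double q zero = refl
  qpow-double q (suc k) = trans (cong (qpow q) (ℕP.*-suc 2 k))
    (trans (sym (ℚP.*-assoc q q (qpow q (2 ℕ.* k)))) (cong (q ℚ.* q ℚ.*_) (qpow-double q k)))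

  neg1^even : ∀ k → qpow neg1 (2 ℕ.* k) ≡ 1ℚ
  neg1^even k = trans (qpow-double neg1 k) (qpow-1 k)

  neg1^-suc : ∀ s → qpow neg1 s ≡ 1ℚ → qpow neg1 (suc s) ≡ neg1
  neg1^-suc s p = trans (cong (neg1 ℚ.*_) p) (ℚP.*-identityʳ neg1)

  neg1^-flip : ∀ a b → qpow neg1 (a ℕ.+ b) ≡ neg1 → qpow neg1 a ≡ ℚ.- qpow neg1 b
  neg1^-flip a b p = begin
    qpow neg1 a ≡⟨ sym (trans (cong (qpow neg1 a ℚ.*_) square) (ℚP.*-identityʳ _)) ⟩
    qpow neg1 a ℚ.* (qpow neg1 b ℚ.* qpow neg1 b) ≡⟨ sym (ℚP.*-assoc (qpow neg1 a) _ _) ⟩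
    qpow neg1 a ℚ.* qpow neg1 b ℚ.* qpow neg1 b ≡⟨ cong (ℚ._* qpow neg1 b) (trans (sym (qpow-+ neg1 a b)) p) ⟩
    neg1 ℚ.* qpow neg1 b ≡⟨ solve 1 (λ x → con neg1 :* x := :- x) refl (qpow neg1 b) ⟩
    ℚ.- qpow neg1 b ∎
    where
    open ≡-Reasoning
    square : qpow neg1 b ℚ.* qpow neg1 b ≡ 1ℚ
    square = trans (qpow-* neg1 neg1 b) (qpow-1 b)

module FiniteSums where

  open Scalars using (two; zero-by-inverse)
  open import Data.Fin using (Fin; toℕ)
  import Data.Fin as F
  open import Data.Rational.Solver
  open +-*-Solver using (solve; _:+_; _:*_; :-_; _:=_; con)

  Σ : ℕ → (ℕ → ℚ) → ℚ
  Σ = sumTo ℚ._+_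

  Σ-cong : ∀ n {f g} → (∀ k → k ≤ n → f k ≡ g k) → Σ n f ≡ Σ n g
  Σ-cong zero p = p 0 z≤n
  Σ-cong (suc n) p = cong₂ ℚ._+_ (Σ-cong n (λ k k≤n → p k (ℕP.m≤n⇒m≤1+n k≤n))) (p (suc n) ℕP.≤-refl)

  Σ-front : ∀ n f → Σ (suc n) f ≡ f 0 ℚ.+ Σ n (λ k → f (suc k))
  Σ-front zero f = refl
  Σ-front (suc n) f = trans (cong (ℚ._+ f (suc (suc n))) (Σ-front n f)) (ℚP.+-assoc (f 0) _ _)

  Σ-rev : ∀ n f → Σ n f ≡ Σ n (λ k → f (n ∸ k))
  Σ-rev zero f = refl
  Σ-rev (suc n) f = begin
    Σ n f ℚ.+ f (suc n) ≡⟨ ℚP.+-comm (Σ n f) (f (suc n)) ⟩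
    f (suc n) ℚ.+ Σ n f ≡⟨ cong (f (suc n) ℚ.+_) (Σ-rev n f) ⟩
    f (suc n) ℚ.+ Σ n (λ k → f (n ∸ k)) ≡⟨ sym (Σ-front n (λ k → f (suc n ∸ k))) ⟩
    Σ (suc n) (λ k → f (suc n ∸ k)) ∎
    where open ≡-Reasoning

  Σ-+ : ∀ n f g → Σ n (λ k → f k ℚ.+ g k) ≡ Σ n f ℚ.+ Σ n g
  Σ-+ zero f g = refl
  Σ-+ (suc n) f g = trans (cong (ℚ._+ (f (suc n) ℚ.+ g (suc n))) (Σ-+ n f g))
    (solve 4 (λ a b c d → (a :+ b) :+ (c :+ d) := (a :+ c) :+ (b :+ d)) refl (Σ n f) (Σ n g) (f (suc n)) (g (suc n)))

  Σ-scal : ∀ n c f → Σ n (λ k → c ℚ.* f k) ≡ c ℚ.* Σ n f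
  Σ-scal zero c f = refl
  Σ-scal (suc n) c f = trans (cong (ℚ._+ c ℚ.* f (suc n)) (Σ-scal n c f)) (sym (ℚP.*-distribˡ-+ c (Σ n f) (f (suc n))))

  Σ-neg : ∀ n f → Σ n (λ k → ℚ.- f k) ≡ ℚ.- Σ n f
  Σ-neg zero f = refl
  Σ-neg (suc n) f = trans (cong (ℚ._+ ℚ.- f (suc n)) (Σ-neg n f)) (sym (ℚP.neg-distrib-+ (Σ n f) (f (suc n))))

  Σ-antisymmetric : ∀ n f → (∀ k → k ≤ n → f (n ∸ k) ≡ ℚ.- f k) → Σ n f ≡ 0ℚ
  Σ-antisymmetric n f p = zero-by-inverse two ½ x refl (begin
    x ℚ.* two ≡⟨ solve 1 (λ x → x :* con two := x :+ :- (:- x)) refl x ⟩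
    x ℚ.+ ℚ.- (ℚ.- x) ≡⟨ cong (λ z → x ℚ.+ ℚ.- z) (sym (Σ-neg n f)) ⟩
    x ℚ.+ ℚ.- Σ n (λ k → ℚ.- f k) ≡⟨ cong (λ z → x ℚ.+ ℚ.- z) (sym (Σ-cong n p)) ⟩
    x ℚ.+ ℚ.- Σ n (λ k → f (n ∸ k)) ≡⟨ cong (λ z → x ℚ.+ ℚ.- z) (sym (Σ-rev n f)) ⟩
    x ℚ.+ ℚ.- x ≡⟨ ℚP.+-inverseʳ x ⟩
    0ℚ ∎)
    where
    open ≡-Reasoning
    x = Σ n f

  Σ-even : ∀ m h → (∀ k → h (suc (2 ℕ.* k)) ≡ 0ℚ) → Σ (2 ℕ.* m) h ≡ Σ m (λ k → h (2 ℕ.* k))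
  Σ-even zero h p = refl
  Σ-even (suc m) h p = begin
    Σ (2 ℕ.* suc m) h ≡⟨ cong (λ z → Σ z h) (ℕP.*-suc 2 m) ⟩
    Σ (2 ℕ.* m) h ℚ.+ h (suc (2 ℕ.* m)) ℚ.+ h (suc (suc (2 ℕ.* m)))
      ≡⟨ cong₂ ℚ._+_ (cong₂ ℚ._+_ (Σ-even m h p) (p m)) (cong h (sym (ℕP.*-suc 2 m))) ⟩
    Σ m (λ k → h (2 ℕ.* k)) ℚ.+ 0ℚ ℚ.+ h (2 ℕ.* suc m)
      ≡⟨ cong (ℚ._+ h (2 ℕ.* suc m)) (ℚP.+-identityʳ (Σ m (λ k → h (2 ℕ.* k)))) ⟩
    Σ (suc m) (λ k → h (2 ℕ.* k)) ∎
    where open ≡-Reasoning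

  Σ-even-suc : ∀ m h → (∀ k → h (suc (2 ℕ.* k)) ≡ 0ℚ) → Σ (suc (2 ℕ.* m)) h ≡ Σ m (λ k → h (2 ℕ.* k))
  Σ-even-suc m h p = trans (cong₂ ℚ._+_ (Σ-even m h p) (p m)) (ℚP.+-identityʳ (Σ m (λ k → h (2 ℕ.* k))))

  sumFin-cong : ∀ n {f g : Fin n → ℚ} → (∀ i → f i ≡ g i) → sumFin n f ≡ sumFin n g
  sumFin-cong zero p = refl
  sumFin-cong (suc n) p = cong₂ ℚ._+_ (p F.zero) (sumFin-cong n (λ i → p (F.suc i)))

  sumFin-Σ : ∀ n h → sumFin (suc n) (λ k → h (toℕ k)) ≡ Σ n h
  sumFin-Σ zero h = ℚP.+-identityʳ (h 0)
  sumFin-Σ (suc n) h = trans (cong (h 0 ℚ.+_) (sumFin-Σ n (λ k → h (suc k)))) (sym (Σ-front n h))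

module PowerSeries where

  open import Algebra.Structures using (IsCommutativeRing)
  open import Algebra.Bundles using (CommutativeRing)
  open import Algebra.Solver.Ring.AlmostCommutativeRing as ACR
    using (AlmostCommutativeRing; _-Raw-AlmostCommutative⟶_)
  import Algebra.Solver.Ring
  open import Data.Product using (_,_)
  open import Data.Maybe as Maybe using ()
  open import Level using (0ℓ)
  open import Relation.Binary.Structures using (IsEquivalence)
  open import Relation.Binary.Consequences using (dec⇒weaklyDec)
  open import Data.Rational.Solver
  open +-*-Solver using (solve; _:+_; _:*_; _:=_)

  Series : Set
  Series = ℕ → ℚ

  infix 4 _≈_
  _≈_ : Series → Series → Set
  f ≈ g = ∀ n → f n ≡ g n

  infixl 6 _+s_
  infixl 7 _*s_
  _+s_ : Series → Series → Series
  (f +s g) n = f n ℚ.+ g n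

  -s_ : Series → Series
  (-s f) n = ℚ.- f n

  cst : ℚ → Series
  cst c zero = c
  cst c (suc n) = 0ℚ

  0s 1s : Series
  0s n = 0ℚ
  1s = cst 1ℚ

  _·_ : ℚ → Series → Series
  (c · f) n = c ℚ.* f n

  -- shift f = (f - f 0)/t.
  shift : Series → Series
  shift f n = f (suc n)

  conv : Series → Series → Series
  conv f g zero = f 0 ℚ.* g 0
  conv f g (suc n) = f 0 ℚ.* g (suc n) ℚ.+ conv (shift f) g n

  _*s_ : Series → Series → Series
  _*s_ = conv

  conv-cong : ∀ {f f' g g'} → f ≈ f' → g ≈ g' → conv f g ≈ conv f' g'
  conv-cong p q zero = cong₂ ℚ._*_ (p 0) (q 0)
  conv-cong p q (suc n) = cong₂ ℚ._+_ (cong₂ ℚ._*_ (p 0) (q (suc n))) (conv-cong (λ k → p (suc k)) q n)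

  conv-last : ∀ f g n → conv f g (suc n) ≡ conv f (shift g) n ℚ.+ f (suc n) ℚ.* g 0
  conv-last f g zero = refl
  conv-last f g (suc n) = begin
    f 0 ℚ.* g (suc (suc n)) ℚ.+ conv (shift f) g (suc n)
      ≡⟨ cong (f 0 ℚ.* g (suc (suc n)) ℚ.+_) (conv-last (shift f) g n) ⟩
    f 0 ℚ.* g (suc (suc n)) ℚ.+ (conv (shift f) (shift g) n ℚ.+ f (suc (suc n)) ℚ.* g 0)
      ≡⟨ sym (ℚP.+-assoc (f 0 ℚ.* g (suc (suc n))) (conv (shift f) (shift g) n) (f (suc (suc n)) ℚ.* g 0)) ⟩
    f 0 ℚ.* g (suc (suc n)) ℚ.+ conv (shift f) (shift g) n ℚ.+ f (suc (suc n)) ℚ.* g 0 ∎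
    where open ≡-Reasoning

  conv-comm : ∀ f g → conv f g ≈ conv g f
  conv-comm f g zero = ℚP.*-comm (f 0) (g 0)
  conv-comm f g (suc n) = begin
    f 0 ℚ.* g (suc n) ℚ.+ conv (shift f) g n ≡⟨ cong₂ ℚ._+_ (ℚP.*-comm (f 0) (g (suc n))) (conv-comm (shift f) g n) ⟩
    g (suc n) ℚ.* f 0 ℚ.+ conv g (shift f) n ≡⟨ ℚP.+-comm (g (suc n) ℚ.* f 0) (conv g (shift f) n) ⟩
    conv g (shift f) n ℚ.+ g (suc n) ℚ.* f 0 ≡⟨ sym (conv-last g f n) ⟩
    conv g f (suc n) ∎
    where open ≡-Reasoning

  conv-distribʳ : ∀ f g h → conv f (g +s h) ≈ conv f g +s conv f h
  conv-distribʳ f g h zero = ℚP.*-distribˡ-+ (f 0) (g 0) (h 0)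
  conv-distribʳ f g h (suc n) = begin
    f 0 ℚ.* (g (suc n) ℚ.+ h (suc n)) ℚ.+ conv (shift f) (g +s h) n
      ≡⟨ cong₂ ℚ._+_ (ℚP.*-distribˡ-+ (f 0) (g (suc n)) (h (suc n))) (conv-distribʳ (shift f) g h n) ⟩
    (f 0 ℚ.* g (suc n) ℚ.+ f 0 ℚ.* h (suc n)) ℚ.+ (conv (shift f) g n ℚ.+ conv (shift f) h n)
      ≡⟨ solve 4 (λ a b c d → (a :+ b) :+ (c :+ d) := (a :+ c) :+ (b :+ d)) refl (f 0 ℚ.* g (suc n)) (f 0 ℚ.* h (suc n)) (conv (shift f) g n) (conv (shift f) h n) ⟩
    (f 0 ℚ.* g (suc n) ℚ.+ conv (shift f) g n) ℚ.+ (f 0 ℚ.* h (suc n) ℚ.+ conv (shift f) h n) ∎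
    where open ≡-Reasoning

  conv-distribˡ : ∀ f g h → conv (g +s h) f ≈ conv g f +s conv h f
  conv-distribˡ f g h n = trans (conv-comm (g +s h) f n) (trans (conv-distribʳ f g h n)
    (cong₂ ℚ._+_ (conv-comm f g n) (conv-comm f h n)))

  conv-scalˡ : ∀ c f g → conv (c · f) g ≈ c · conv f g
  conv-scalˡ c f g zero = ℚP.*-assoc c (f 0) (g 0)
  conv-scalˡ c f g (suc n) = begin
    c ℚ.* f 0 ℚ.* g (suc n) ℚ.+ conv (shift (c · f)) g n
      ≡⟨ cong₂ ℚ._+_ (ℚP.*-assoc c (f 0) (g (suc n))) (conv-scalˡ c (shift f) g n) ⟩
    c ℚ.* (f 0 ℚ.* g (suc n)) ℚ.+ c ℚ.* conv (shift f) g n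
      ≡⟨ sym (ℚP.*-distribˡ-+ c (f 0 ℚ.* g (suc n)) (conv (shift f) g n)) ⟩
    c ℚ.* (f 0 ℚ.* g (suc n) ℚ.+ conv (shift f) g n) ∎
    where open ≡-Reasoning

  conv-assoc : ∀ f g h → conv (conv f g) h ≈ conv f (conv g h)
  conv-assoc f g h zero = ℚP.*-assoc (f 0) (g 0) (h 0)
  conv-assoc f g h (suc n) = begin
    f 0 ℚ.* g 0 ℚ.* h (suc n) ℚ.+ conv (shift (conv f g)) h n
      ≡⟨ cong (f 0 ℚ.* g 0 ℚ.* h (suc n) ℚ.+_)
           (trans (conv-distribˡ h (f 0 · shift g) (conv (shift f) g) n)
            (cong₂ ℚ._+_ (conv-scalˡ (f 0) (shift g) h n) (conv-assoc (shift f) g h n))) ⟩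
    f 0 ℚ.* g 0 ℚ.* h (suc n) ℚ.+ (f 0 ℚ.* conv (shift g) h n ℚ.+ conv (shift f) (conv g h) n)
      ≡⟨ solve 5 (λ a b c d e → a :* b :* c :+ (a :* d :+ e) := a :* (b :* c :+ d) :+ e) refl
           (f 0) (g 0) (h (suc n)) (conv (shift g) h n) (conv (shift f) (conv g h) n) ⟩
    f 0 ℚ.* (g 0 ℚ.* h (suc n) ℚ.+ conv (shift g) h n) ℚ.+ conv (shift f) (conv g h) n ∎
    where open ≡-Reasoning

  conv-zeroˡ : ∀ f → conv 0s f ≈ 0s
  conv-zeroˡ f zero = ℚP.*-zeroˡ (f 0)
  conv-zeroˡ f (suc n) = trans (cong₂ ℚ._+_ (ℚP.*-zeroˡ (f (suc n))) (conv-zeroˡ f n)) refl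

  conv-identityˡ : ∀ f → conv 1s f ≈ f
  conv-identityˡ f zero = ℚP.*-identityˡ (f 0)
  conv-identityˡ f (suc n) = trans (cong₂ ℚ._+_ (ℚP.*-identityˡ (f (suc n))) (conv-zeroˡ f n)) (ℚP.+-identityʳ _)

  const-scalar : ∀ c f → c · f ≈ cst c *s f
  const-scalar c f zero = refl
  const-scalar c f (suc n) = sym (trans (cong (c ℚ.* f (suc n) ℚ.+_) (conv-zeroˡ f n)) (ℚP.+-identityʳ _))

  cst-* : ∀ a b → cst (a ℚ.* b) ≈ conv (cst a) (cst b)
  cst-* a b zero = refl
  cst-* a b (suc n) = sym (trans (cong (a ℚ.* 0ℚ ℚ.+_) (conv-zeroˡ (cst b) n))
    (trans (ℚP.+-identityʳ _) (ℚP.*-zeroʳ a)))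

  ≈-isEquivalence : IsEquivalence _≈_
  ≈-isEquivalence = record { refl = λ n → refl ; sym = λ p n → sym (p n) ; trans = λ p q n → trans (p n) (q n) }

  series-isCommutativeRing : IsCommutativeRing _≈_ _+s_ conv -s_ 0s 1s
  series-isCommutativeRing = record
    { isRing = record
      { +-isAbelianGroup = record
        { isGroup = record
          { isMonoid = record
            { isSemigroup = record
              { isMagma = record { isEquivalence = ≈-isEquivalence ; ∙-cong = λ p q n → cong₂ ℚ._+_ (p n) (q n) }
              ; assoc = λ f g h n → ℚP.+-assoc (f n) (g n) (h n) }
            ; identity = (λ f n → ℚP.+-identityˡ (f n)) , (λ f n → ℚP.+-identityʳ (f n)) }
          ; inverse = (λ f n → ℚP.+-inverseˡ (f n)) , (λ f n → ℚP.+-inverseʳ (f n))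
          ; ⁻¹-cong = λ p n → cong ℚ.-_ (p n) }
        ; comm = λ f g n → ℚP.+-comm (f n) (g n) }
      ; *-cong = conv-cong
      ; *-assoc = conv-assoc
      ; *-identity = conv-identityˡ , (λ f n → trans (conv-comm f 1s n) (conv-identityˡ f n))
      ; distrib = conv-distribʳ , conv-distribˡ }
    ; *-comm = conv-comm }

  series-commutativeRing : CommutativeRing 0ℓ 0ℓ
  series-commutativeRing = record { isCommutativeRing = series-isCommutativeRing }

  -- The constants ℚ → Series form a ring homomorphism, so the ring solver
  -- proves polynomial identities between series with rational coefficients.
  cst-homomorphism : CommutativeRing.rawRing ℚP.+-*-commutativeRing
                       -Raw-AlmostCommutative⟶ ACR.fromCommutativeRing series-commutativeRing
  cst-homomorphism = record
    { ⟦_⟧ = cst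
    ; +-homo = λ { a b zero → refl ; a b (suc n) → sym (ℚP.+-identityʳ 0ℚ) }
    ; *-homo = cst-*
    ; -‿homo = λ { a zero → refl ; a (suc n) → refl }
    ; 0-homo = λ { zero → refl ; (suc n) → refl }
    ; 1-homo = λ { zero → refl ; (suc n) → refl } }

  module SeriesSolver = Algebra.Solver.Ring (CommutativeRing.rawRing ℚP.+-*-commutativeRing)
    (ACR.fromCommutativeRing series-commutativeRing) cst-homomorphism
    (λ a b → Maybe.map (λ e n → cong (λ z → cst z n) e) (dec⇒weaklyDec ℚP._≟_ a b))

  conv-Σ : ∀ f g n → conv f g n ≡ FiniteSums.Σ n (λ j → f j ℚ.* g (n ∸ j))
  conv-Σ f g zero = refl
  conv-Σ f g (suc n) = trans (cong (f 0 ℚ.* g (suc n) ℚ.+_) (conv-Σ (shift f) g n))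
    (sym (FiniteSums.Σ-front n (λ j → f j ℚ.* g (suc n ∸ j))))

module SeriesOperators where

  open Scalars
  open PowerSeries
  open import Data.Nat.Induction using (<-rec)
  open import Data.Rational.Solver
  open +-*-Solver using (solve; _:+_; _:*_; _:=_; con)

  ≈sym : ∀ {f g} → f ≈ g → g ≈ f
  ≈sym p n = sym (p n)

  ≈trans : ∀ {f g h} → f ≈ g → g ≈ h → f ≈ h
  ≈trans p q n = trans (p n) (q n)

  +cong : ∀ {a b c d} → a ≈ b → c ≈ d → a +s c ≈ b +s d
  +cong p q n = cong₂ ℚ._+_ (p n) (q n)

  *cong : ∀ {a b c d} → a ≈ b → c ≈ d → a *s c ≈ b *s d
  *cong = conv-cong

  diff-zero : ∀ {a b} → a ≈ b → a +s -s b ≈ 0s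
  diff-zero {a} {b} p n = trans (cong (ℚ._+ ℚ.- b n) (p n)) (ℚP.+-inverseʳ (b n))

  zero-diff : ∀ {a b} → a +s -s b ≈ 0s → a ≈ b
  zero-diff {a} {b} p n = Scalars.diff-zero-ℚ (a n) (b n) (p n)

  *-zero : ∀ m {a} → a ≈ 0s → m *s a ≈ 0s
  *-zero m {a} p = ≈trans (conv-cong {f = m} (λ n → refl) p) (λ n → trans (conv-comm m 0s n) (conv-zeroˡ m n))

  +-zero : ∀ {a b} → a ≈ 0s → b ≈ 0s → a +s b ≈ 0s
  +-zero p q n = trans (cong₂ ℚ._+_ (p n) (q n)) (ℚP.+-identityʳ 0ℚ)

  neg-zero : ∀ {a} → a ≈ 0s → -s a ≈ 0s
  neg-zero p n = cong ℚ.-_ (p n)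

  -- The Euler operator θ = t·d/dt, acting by tⁿ ↦ n·tⁿ.
  θ : Series → Series
  θ f n = ℕ→ℚ n ℚ.* f n

  θ-cong : ∀ {f g} → f ≈ g → θ f ≈ θ g
  θ-cong p n = cong (ℕ→ℚ n ℚ.*_) (p n)

  θ-+ : ∀ f g → θ (f +s g) ≈ θ f +s θ g
  θ-+ f g n = ℚP.*-distribˡ-+ (ℕ→ℚ n) (f n) (g n)

  θ-neg : ∀ f → θ (-s f) ≈ -s θ f
  θ-neg f n = sym (ℚP.neg-distribʳ-* (ℕ→ℚ n) (f n))

  θ-cst : ∀ c → θ (cst c) ≈ 0s
  θ-cst c zero = ℚP.*-zeroˡ c
  θ-cst c (suc n) = ℚP.*-zeroʳ (ℕ→ℚ (suc n))

  θ-shift : ∀ f → shift (θ f) ≈ θ (shift f) +s shift f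
  θ-shift f k = trans (cong (ℚ._* f (suc k)) (ℕ→ℚ-suc k)) (trans (ℚP.*-distribʳ-+ (f (suc k)) (ℕ→ℚ k) 1ℚ)
     (cong (ℕ→ℚ k ℚ.* f (suc k) ℚ.+_) (ℚP.*-identityˡ (f (suc k)))))

  θ-leibniz : ∀ f g → θ (conv f g) ≈ conv (θ f) g +s conv f (θ g)
  θ-leibniz f g zero =
    solve 2 (λ a b → con 0ℚ :* (a :* b) := con 0ℚ :* a :* b :+ a :* (con 0ℚ :* b)) refl (f 0) (g 0)
  θ-leibniz f g (suc m) = begin
    ℕ→ℚ (suc m) ℚ.* (f 0 ℚ.* g (suc m) ℚ.+ conv (shift f) g m)
      ≡⟨ cong (ℚ._* (f 0 ℚ.* g (suc m) ℚ.+ conv (shift f) g m)) (ℕ→ℚ-suc m) ⟩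
    (c ℚ.+ 1ℚ) ℚ.* (f 0 ℚ.* g (suc m) ℚ.+ Bv)
      ≡⟨ solve 4 (λ c f0 g1 B → (c :+ con 1ℚ) :* (f0 :* g1 :+ B) := (f0 :* ((c :+ con 1ℚ) :* g1) :+ c :* B) :+ B) refl c (f 0) (g (suc m)) Bv ⟩
    (f 0 ℚ.* ((c ℚ.+ 1ℚ) ℚ.* g (suc m)) ℚ.+ c ℚ.* Bv) ℚ.+ Bv
      ≡⟨ cong₂ ℚ._+_ (cong₂ ℚ._+_ (cong (λ z → f 0 ℚ.* (z ℚ.* g (suc m))) (sym (ℕ→ℚ-suc m))) (θ-leibniz (shift f) g m)) refl ⟩
    (Y ℚ.+ (Av ℚ.+ Cc)) ℚ.+ Bv
      ≡⟨ solve 5 (λ x A Cc B y → (x :+ (A :+ Cc)) :+ B := (con 0ℚ :* y :+ (A :+ B)) :+ (x :+ Cc)) refl Y Av Cc Bv (f 0 ℚ.* g (suc m)) ⟩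
    (0ℚ ℚ.* (f 0 ℚ.* g (suc m)) ℚ.+ (Av ℚ.+ Bv)) ℚ.+ (Y ℚ.+ Cc)
      ≡⟨ cong₂ ℚ._+_ (cong₂ ℚ._+_ (sym (ℚP.*-assoc 0ℚ (f 0) (g (suc m)))) (sym (conv-distribˡ g (θ (shift f)) (shift f) m))) refl ⟩
    (0ℚ ℚ.* f 0 ℚ.* g (suc m) ℚ.+ conv (θ (shift f) +s shift f) g m) ℚ.+ (Y ℚ.+ Cc)
      ≡⟨ cong (λ z → (0ℚ ℚ.* f 0 ℚ.* g (suc m) ℚ.+ z) ℚ.+ (Y ℚ.+ Cc)) (sym (conv-cong (θ-shift f) (λ k → refl) m)) ⟩
    conv (θ f) g (suc m) ℚ.+ conv f (θ g) (suc m) ∎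
    where
    open ≡-Reasoning
    c = ℕ→ℚ m
    Bv = conv (shift f) g m
    Av = conv (θ (shift f)) g m
    Cc = conv (shift f) (θ g) m
    Y = f 0 ℚ.* (ℕ→ℚ (suc m) ℚ.* g (suc m))

  θ-const* : ∀ c f → θ (cst c *s f) ≈ cst c *s θ f
  θ-const* c f = ≈trans (θ-leibniz (cst c) f) (≈trans (+cong (*cong (θ-cst c) (λ n → refl)) (λ n → refl))
    (λ n → trans (cong (ℚ._+ conv (cst c) (θ f) n) (conv-zeroˡ f n)) (ℚP.+-identityˡ _)))

  θ-zero-constant : ∀ h → θ h ≈ 0s → h ≈ cst (h 0)
  θ-zero-constant h p zero = refl
  θ-zero-constant h p (suc n) = zero-by-inverse (ℕ→ℚ (suc n)) (invSuc n) (h (suc n)) (suc*invSuc n)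
    (trans (ℚP.*-comm (h (suc n)) _) (p (suc n)))

  -- Substitution f(t) ↦ f(ct).
  scale : ℚ → Series → Series
  scale c f n = qpow c n ℚ.* f n

  scale-cong : ∀ c {f g} → f ≈ g → scale c f ≈ scale c g
  scale-cong c p n = cong (qpow c n ℚ.*_) (p n)

  scale-+ : ∀ c f g → scale c (f +s g) ≈ scale c f +s scale c g
  scale-+ c f g n = ℚP.*-distribˡ-+ (qpow c n) (f n) (g n)

  scale-neg : ∀ c f → scale c (-s f) ≈ -s scale c f
  scale-neg c f n = sym (ℚP.neg-distribʳ-* (qpow c n) (f n))

  scale-cst : ∀ c d → scale c (cst d) ≈ cst d
  scale-cst c d zero = ℚP.*-identityˡ d
  scale-cst c d (suc n) = ℚP.*-zeroʳ (qpow c (suc n))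

  scale-zero : ∀ c {f} → f ≈ 0s → scale c f ≈ 0s
  scale-zero c p n = trans (cong (qpow c n ℚ.*_) (p n)) (ℚP.*-zeroʳ (qpow c n))

  scale-* : ∀ c f g → scale c (f *s g) ≈ scale c f *s scale c g
  scale-* c f g zero = solve 2 (λ a b → con 1ℚ :* (a :* b) := (con 1ℚ :* a) :* (con 1ℚ :* b)) refl (f 0) (g 0)
  scale-* c f g (suc m) = sym (begin
    1ℚ ℚ.* f 0 ℚ.* (c ℚ.* qpow c m ℚ.* g (suc m)) ℚ.+ conv (shift (scale c f)) (scale c g) m
      ≡⟨ cong (1ℚ ℚ.* f 0 ℚ.* (c ℚ.* qpow c m ℚ.* g (suc m)) ℚ.+_)
          (trans (conv-cong {g = scale c g} (λ k → ℚP.*-assoc c (qpow c k) (f (suc k))) (λ k → refl) m)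
            (trans (conv-scalˡ c (scale c (shift f)) (scale c g) m) (cong (c ℚ.*_) (sym (scale-* c (shift f) g m))))) ⟩
    1ℚ ℚ.* f 0 ℚ.* (c ℚ.* qpow c m ℚ.* g (suc m)) ℚ.+ c ℚ.* (qpow c m ℚ.* conv (shift f) g m)
      ≡⟨ solve 5 (λ f0 c p g1 B → con 1ℚ :* f0 :* (c :* p :* g1) :+ c :* (p :* B) := c :* p :* (f0 :* g1 :+ B))
           refl (f 0) c (qpow c m) (g (suc m)) (conv (shift f) g m) ⟩
    c ℚ.* qpow c m ℚ.* (f 0 ℚ.* g (suc m) ℚ.+ conv (shift f) g m) ∎)
    where open ≡-Reasoning

  scale-scale : ∀ a b f → scale a (scale b f) ≈ scale (a ℚ.* b) f
  scale-scale a b f n = trans (sym (ℚP.*-assoc (qpow a n) (qpow b n) (f n))) (cong (ℚ._* f n) (qpow-* a b n))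

  scale-1 : ∀ f → scale 1ℚ f ≈ f
  scale-1 f n = trans (cong (ℚ._* f n) (qpow-1 n)) (ℚP.*-identityˡ (f n))

  scale-1s+ : ∀ c f → scale c (1s +s f) ≈ 1s +s scale c f
  scale-1s+ c f = ≈trans (scale-+ c 1s f) (+cong (scale-cst c 1ℚ) (λ n → refl))

  θ-scale : ∀ c f → θ (scale c f) ≈ scale c (θ f)
  θ-scale c f n = solve 3 (λ a b x → a :* (b :* x) := b :* (a :* x)) refl (ℕ→ℚ n) (qpow c n) (f n)

  timesX : Series → Series
  timesX f zero = 0ℚ
  timesX f (suc n) = f n

  X : Series
  X = timesX 1s

  X* : ∀ f → X *s f ≈ timesX f
  X* f zero = ℚP.*-zeroˡ (f 0)
  X* f (suc n) = trans (cong (ℚ._+ conv 1s f n) (ℚP.*-zeroˡ (f (suc n))))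
    (trans (ℚP.+-identityˡ (conv 1s f n)) (conv-identityˡ f n))

  X-cancel : ∀ {f g} → X *s f ≈ X *s g → f ≈ g
  X-cancel {f} {g} p n = trans (sym (X* f (suc n))) (trans (p (suc n)) (X* g (suc n)))

  X-cancel-zero : ∀ {f} → X *s f ≈ 0s → f ≈ 0s
  X-cancel-zero {f} p = X-cancel (≈trans p (λ n → sym (trans (conv-comm X 0s n) (conv-zeroˡ X n))))

  θX : θ X ≈ X
  θX zero = refl
  θX (suc zero) = refl
  θX (suc (suc n)) = ℚP.*-zeroʳ (ℕ→ℚ (suc (suc n)))

  scale-timesX : ∀ c f → scale c (timesX f) ≈ c · timesX (scale c f)
  scale-timesX c f zero = trans (ℚP.*-zeroʳ 1ℚ) (sym (ℚP.*-zeroʳ c))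
  scale-timesX c f (suc n) = ℚP.*-assoc c (qpow c n) (f n)

  scale-X : ∀ c → scale c X ≈ cst c *s X
  scale-X c = ≈trans (scale-timesX c 1s) (≈trans (λ n → cong (c ℚ.*_) (scale-timesX-1 n)) (const-scalar c X))
    where
    scale-timesX-1 : timesX (scale c 1s) ≈ X
    scale-timesX-1 zero = refl
    scale-timesX-1 (suc n) = scale-cst c 1ℚ n

  conv-leading : ∀ n f h → (∀ k → k < n → f k ≡ 0ℚ) → conv f h n ≡ f n ℚ.* h 0
  conv-leading zero f h p = refl
  conv-leading (suc n) f h p = begin
    f 0 ℚ.* h (suc n) ℚ.+ conv (shift f) h n
      ≡⟨ cong₂ ℚ._+_ (cong (ℚ._* h (suc n)) (p 0 (s≤s z≤n))) (conv-leading n (shift f) h (λ k k<n → p (suc k) (s≤s k<n))) ⟩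
    0ℚ ℚ.* h (suc n) ℚ.+ f (suc n) ℚ.* h 0 ≡⟨ cong (ℚ._+ f (suc n) ℚ.* h 0) (ℚP.*-zeroˡ (h (suc n))) ⟩
    0ℚ ℚ.+ f (suc n) ℚ.* h 0 ≡⟨ ℚP.+-identityˡ _ ⟩
    f (suc n) ℚ.* h 0 ∎
    where open ≡-Reasoning

  cancel-factor : ∀ f g c c⁻¹ → c ℚ.* c⁻¹ ≡ 1ℚ → g 0 ≡ c → conv f g ≈ 0s → f ≈ 0s
  cancel-factor f g c c⁻¹ inv g0 h = <-rec (λ n → f n ≡ 0ℚ) (λ n ih → step n (λ k → ih {k}))
    where
    step : ∀ n → (∀ k → k < n → f k ≡ 0ℚ) → f n ≡ 0ℚ
    step n ih = zero-by-inverse c c⁻¹ (f n) inv (trans (cong (f n ℚ.*_) (sym g0)) (trans (sym (conv-leading n f g ih)) (h n)))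

  cancel-X-factor : ∀ f g c c⁻¹ → c ℚ.* c⁻¹ ≡ 1ℚ → g 0 ≡ c → X *s (f *s g) ≈ 0s → f ≈ 0s
  cancel-X-factor f g c c⁻¹ inv g0 h = cancel-factor f g c c⁻¹ inv g0 (X-cancel-zero h)

module Exponential where

  open Scalars
  open PowerSeries
  open PowerSeries.SeriesSolver using (solve; _:+_; _:*_; :-_; _:=_; con)
  open SeriesOperators
  open import Algebra.Bundles using (CommutativeRing)
  open import Relation.Binary.Reasoning.Setoid (CommutativeRing.setoid series-commutativeRing)

  e^t : Series
  e^t n = invFact n

  θe^t : θ e^t ≈ timesX e^t
  θe^t zero = ℚP.*-zeroˡ 1ℚ
  θe^t (suc n) = suc*invFact-suc n

  θ≈timesX-unique : ∀ f g → θ f ≈ timesX f → θ g ≈ timesX g → f 0 ≡ g 0 → f ≈ g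
  θ≈timesX-unique f g pf pg z zero = z
  θ≈timesX-unique f g pf pg z (suc n) =
    trans (solve-by-inverse (ℕ→ℚ (suc n)) (invSuc n) (f (suc n)) (f n) (suc*invSuc n) (pf (suc n)))
      (trans (cong (invSuc n ℚ.*_) (θ≈timesX-unique f g pf pg z n))
        (sym (solve-by-inverse (ℕ→ℚ (suc n)) (invSuc n) (g (suc n)) (g n) (suc*invSuc n) (pg (suc n)))))

  e^½t : Series
  e^½t = scale ½ e^t

  V : Series
  V = shift e^½t

  e^½t-split : e^½t ≈ 1s +s X *s V
  e^½t-split zero = refl
  e^½t-split (suc n) = sym (trans (cong (0ℚ ℚ.+_) (X* V (suc n))) (ℚP.+-identityˡ _))

  θe^½t : θ e^½t ≈ cst ½ *s (X *s e^½t)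
  θe^½t = begin
    θ e^½t ≈⟨ ≈trans (θ-scale ½ e^t) (scale-cong ½ θe^t) ⟩
    scale ½ (timesX e^t) ≈⟨ scale-timesX ½ e^t ⟩
    ½ · timesX e^½t ≈⟨ const-scalar ½ (timesX e^½t) ⟩
    cst ½ *s timesX e^½t ≈⟨ *cong {cst ½} (λ n → refl) (≈sym (X* e^½t)) ⟩
    cst ½ *s (X *s e^½t) ∎

  e^½t² : e^½t *s e^½t ≈ e^t
  e^½t² = θ≈timesX-unique (e^½t *s e^½t) e^t θsquare θe^t refl
    where
    θsquare : θ (e^½t *s e^½t) ≈ timesX (e^½t *s e^½t)
    θsquare = begin
      θ (e^½t *s e^½t) ≈⟨ θ-leibniz e^½t e^½t ⟩
      θ e^½t *s e^½t +s e^½t *s θ e^½t ≈⟨ +cong (*cong θe^½t (λ n → refl)) (*cong {e^½t} (λ n → refl) θe^½t) ⟩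
      cst ½ *s (X *s e^½t) *s e^½t +s e^½t *s (cst ½ *s (X *s e^½t))
        ≈⟨ solve 2 (λ t u → con ½ :* (t :* u) :* u :+ u :* (con ½ :* (t :* u)) := t :* (u :* u)) (λ n → refl) X e^½t ⟩
      X *s (e^½t *s e^½t) ≈⟨ X* (e^½t *s e^½t) ⟩
      timesX (e^½t *s e^½t) ∎

  scale2-e^½t : scale two e^½t ≈ e^t
  scale2-e^½t = ≈trans (scale-scale two ½ e^t) (scale-1 e^t)

  -- (eᵗ - 1)/t = V·(2 + tV), from eᵗ = (1 + tV)².
  shift-e^t : shift e^t ≈ V *s (cst two +s X *s V)
  shift-e^t = X-cancel (begin
    X *s shift e^t ≈⟨ ≈trans (X* (shift e^t)) X*shift ⟩
    e^t +s -s 1s ≈⟨ +cong (≈sym e^½t²) (λ n → refl) ⟩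
    e^½t *s e^½t +s -s 1s ≈⟨ +cong (*cong e^½t-split e^½t-split) (λ n → refl) ⟩
    (1s +s X *s V) *s (1s +s X *s V) +s -s 1s
      ≈⟨ solve 2 (λ t v → (con 1ℚ :+ t :* v) :* (con 1ℚ :+ t :* v) :+ :- con 1ℚ := t :* (v :* (con two :+ t :* v))) (λ n → refl) X V ⟩
    X *s (V *s (cst two +s X *s V)) ∎)
    where
    X*shift : timesX (shift e^t) ≈ e^t +s -s 1s
    X*shift zero = refl
    X*shift (suc n) = sym (ℚP.+-identityʳ (e^t (suc n)))

module BernoulliRecursions where

  open Scalars
  open FiniteSums
  open PowerSeries
  open Exponential using (e^t; V)
  open import Data.Fin using (Fin; toℕ; fromℕ)
  import Data.Fin as F
  open import Data.Vec using (Vec; []; _∷_; _∷ʳ_; lookup)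
  open import Data.Sum using (_⊎_; inj₁; inj₂)
  open import Data.Product using (Σ-syntax; _×_; _,_)
  open import Data.Nat.Combinatorics using (_C_; nCk≡nC[n∸k]; nC1≡n)
  open import Data.Rational.Solver
  open +-*-Solver using (solve; _:+_; _:*_; :-_; _:=_; con)

  snoc-last : ∀ {n} (xs : Vec ℚ n) x → lookup (xs ∷ʳ x) (fromℕ n) ≡ x
  snoc-last [] x = refl
  snoc-last (y ∷ ys) x = snoc-last ys x

  snoc-view : ∀ {n} (xs : Vec ℚ n) x (i : Fin (suc n)) →
    (toℕ i ≡ n × lookup (xs ∷ʳ x) i ≡ x) ⊎ (Σ[ j ∈ Fin n ] (toℕ j ≡ toℕ i × lookup (xs ∷ʳ x) i ≡ lookup xs j))
  snoc-view [] x F.zero = inj₁ (refl , refl)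
  snoc-view (y ∷ ys) x F.zero = inj₂ (F.zero , refl , refl)
  snoc-view (y ∷ ys) x (F.suc i) with snoc-view ys x i
  ... | inj₁ (p , q) = inj₁ (cong suc p , q)
  ... | inj₂ (j , p , q) = inj₂ (F.suc j , cong suc p , q)

  bernVec-lookup : ∀ n (i : Fin (suc n)) → lookup (bernVec n) i ≡ B (toℕ i)
  bernVec-lookup zero F.zero = refl
  bernVec-lookup (suc m) i with snoc-view (bernVec m) new i
    where
    new = ℚ.- invSuc (suc m) ℚ.* sumFin (suc m) (λ k → ℕ→ℚ (suc (suc m) C toℕ k) ℚ.* lookup (bernVec m) k)
  ... | inj₁ (p , q) = trans q (trans (sym (snoc-last (bernVec m) _)) (cong B (sym p)))
  ... | inj₂ (j , p , q) = trans q (trans (bernVec-lookup m j) (cong B p))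

  B-rec : ∀ m → B (suc m) ≡ ℚ.- invSuc (suc m) ℚ.* Σ m (λ k → ℕ→ℚ (suc (suc m) C k) ℚ.* B k)
  B-rec m = trans (snoc-last (bernVec m) _)
    (cong (ℚ.- invSuc (suc m) ℚ.*_) (trans (sumFin-cong (suc m) (λ i → cong (ℕ→ℚ (suc (suc m) C toℕ i) ℚ.*_) (bernVec-lookup m i)))
       (sumFin-Σ m (λ k → ℕ→ℚ (suc (suc m) C k) ℚ.* B k))))

  choose-pred : ∀ m → suc (suc m) C suc m ≡ suc (suc m)
  choose-pred m = trans (nCk≡nC[n∸k] (ℕP.n≤1+n (suc m))) (trans (cong (suc (suc m) C_) (ℕP.m+n∸n≡m 1 m)) (nC1≡n (suc (suc m))))

  bernoulli-sum : ∀ m → Σ (suc m) (λ k → ℕ→ℚ (suc (suc m) C k) ℚ.* B k) ≡ 0ℚ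
  bernoulli-sum m = begin
    A ℚ.+ ℕ→ℚ (suc (suc m) C suc m) ℚ.* B (suc m) ≡⟨ cong (λ z → A ℚ.+ ℕ→ℚ z ℚ.* B (suc m)) (choose-pred m) ⟩
    A ℚ.+ ℕ→ℚ (suc (suc m)) ℚ.* B (suc m) ≡⟨ cong (λ z → A ℚ.+ ℕ→ℚ (suc (suc m)) ℚ.* z) (B-rec m) ⟩
    A ℚ.+ ℕ→ℚ (suc (suc m)) ℚ.* (ℚ.- invSuc (suc m) ℚ.* A)
      ≡⟨ solve 3 (λ a n i → a :+ n :* (:- i :* a) := a :* (con 1ℚ :+ :- (n :* i))) refl A (ℕ→ℚ (suc (suc m))) (invSuc (suc m)) ⟩
    A ℚ.* (1ℚ ℚ.+ ℚ.- (ℕ→ℚ (suc (suc m)) ℚ.* invSuc (suc m))) ≡⟨ cong (λ z → A ℚ.* (1ℚ ℚ.+ ℚ.- z)) (suc*invSuc (suc m)) ⟩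
    A ℚ.* (1ℚ ℚ.+ ℚ.- 1ℚ) ≡⟨ ℚP.*-zeroʳ A ⟩
    0ℚ ∎
    where
    open ≡-Reasoning
    A = Σ m (λ k → ℕ→ℚ (suc (suc m) C k) ℚ.* B k)

  β : Series
  β n = B n ℚ.* invFact n

  β-defining-series : β *s shift e^t ≈ 1s
  β-defining-series zero = refl
  β-defining-series (suc m) = begin
    conv β (shift e^t) (suc m) ≡⟨ conv-Σ β (shift e^t) (suc m) ⟩
    Σ (suc m) (λ j → β j ℚ.* invFact (suc (suc m ∸ j))) ≡⟨ Σ-cong (suc m) term ⟩
    Σ (suc m) (λ j → invFact (suc (suc m)) ℚ.* (ℕ→ℚ (suc (suc m) C j) ℚ.* B j))
      ≡⟨ Σ-scal (suc m) (invFact (suc (suc m))) (λ j → ℕ→ℚ (suc (suc m) C j) ℚ.* B j) ⟩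
    invFact (suc (suc m)) ℚ.* Σ (suc m) (λ j → ℕ→ℚ (suc (suc m) C j) ℚ.* B j) ≡⟨ cong (invFact (suc (suc m)) ℚ.*_) (bernoulli-sum m) ⟩
    invFact (suc (suc m)) ℚ.* 0ℚ ≡⟨ ℚP.*-zeroʳ (invFact (suc (suc m))) ⟩
    0ℚ ∎
    where
    open ≡-Reasoning
    term : ∀ j → j ≤ suc m → β j ℚ.* invFact (suc (suc m ∸ j)) ≡ invFact (suc (suc m)) ℚ.* (ℕ→ℚ (suc (suc m) C j) ℚ.* B j)
    term j j≤ = begin
      B j ℚ.* invFact j ℚ.* invFact (suc (suc m ∸ j)) ≡⟨ cong (λ z → B j ℚ.* invFact j ℚ.* invFact z) (sym (ℕP.+-∸-assoc 1 j≤)) ⟩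
      B j ℚ.* invFact j ℚ.* invFact (suc (suc m) ∸ j)
        ≡⟨ ℚP.*-assoc (B j) (invFact j) (invFact (suc (suc m) ∸ j)) ⟩
      B j ℚ.* (invFact j ℚ.* invFact (suc (suc m) ∸ j)) ≡⟨ cong (B j ℚ.*_) (sym (choose*invFact (suc (suc m)) j (ℕP.m≤n⇒m≤1+n j≤))) ⟩
      B j ℚ.* (ℕ→ℚ (suc (suc m) C j) ℚ.* invFact (suc (suc m)))
        ≡⟨ solve 3 (λ b c f → b :* (c :* f) := f :* (c :* b)) refl (B j) (ℕ→ℚ (suc (suc m) C j)) (invFact (suc (suc m))) ⟩
      invFact (suc (suc m)) ℚ.* (ℕ→ℚ (suc (suc m) C j) ℚ.* B j) ∎

  -- B′ₘ₊₁ = 2^{-(m+1)}·Bₘ₊₁: the recursion for B′ is that of B rescaled.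
  B′-B : ∀ m → B′ (suc m) ≡ qpow ½ (suc m) ℚ.* B (suc m)
  B′-B m = begin
    ℚ.- invSuc (suc m) ℚ.* Σ m (λ k → ℕ→ℚ (suc (suc m) C k) ℚ.* h ℚ.* B k)
      ≡⟨ cong (ℚ.- invSuc (suc m) ℚ.*_) (trans (Σ-cong m (λ k _ → solve 3 (λ c h b → c :* h :* b := h :* (c :* b)) refl (ℕ→ℚ (suc (suc m) C k)) h (B k)))
           (Σ-scal m h (λ k → ℕ→ℚ (suc (suc m) C k) ℚ.* B k))) ⟩
    ℚ.- invSuc (suc m) ℚ.* (h ℚ.* A) ≡⟨ solve 3 (λ i h a → :- i :* (h :* a) := h :* (:- i :* a)) refl (invSuc (suc m)) h A ⟩
    h ℚ.* (ℚ.- invSuc (suc m) ℚ.* A) ≡⟨ cong (h ℚ.*_) (sym (B-rec m)) ⟩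
    h ℚ.* B (suc m) ∎
    where
    open ≡-Reasoning
    h = qpow ½ (suc m)
    A = Σ m (λ k → ℕ→ℚ (suc (suc m) C k) ℚ.* B k)

  B*-β-V : ∀ r → B* (suc (suc r)) ℚ.* invFact (suc (suc r)) ≡ β (suc (suc r)) ℚ.+ ℚ.- (two ℚ.* conv β V (suc (suc r)))
  B*-β-V r = sym (begin
    β s ℚ.+ ℚ.- (two ℚ.* conv β V s)
      ≡⟨ cong (λ z → β s ℚ.+ ℚ.- (two ℚ.* z)) (trans (conv-Σ β V s) (cong (λ z → Σ (suc r) (λ j → β j ℚ.* V (s ∸ j)) ℚ.+ β s ℚ.* V z) (ℕP.n∸n≡0 s))) ⟩
    β s ℚ.+ ℚ.- (two ℚ.* (Σ' ℚ.+ β s ℚ.* ½)) ≡⟨ solve 2 (λ b S → b :+ :- (con two :* (S :+ b :* con ½)) := :- (con two :* S)) refl (β s) Σ' ⟩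
    ℚ.- (two ℚ.* Σ')
      ≡⟨ cong ℚ.-_ (trans (sym (Σ-scal (suc r) two _)) (trans (Σ-cong (suc r) term) (Σ-scal (suc r) (invSuc s ℚ.* invFact s) g))) ⟩
    ℚ.- (invSuc s ℚ.* invFact s ℚ.* Σ (suc r) g) ≡⟨ solve 3 (λ i f S → :- (i :* f :* S) := :- i :* S :* f) refl (invSuc s) (invFact s) (Σ (suc r) g) ⟩
    ℚ.- invSuc s ℚ.* Σ (suc r) g ℚ.* invFact s ∎)
    where
    open ≡-Reasoning
    s = suc (suc r)
    Σ' = Σ (suc r) (λ j → β j ℚ.* V (s ∸ j))
    g : ℕ → ℚ
    g k = ℕ→ℚ (suc s C k) ℚ.* twoNeg (s ∸ k) ℚ.* B k
    term : ∀ k → k ≤ suc r → two ℚ.* (β k ℚ.* V (s ∸ k)) ≡ invSuc s ℚ.* invFact s ℚ.* g k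
    term k k≤ = begin
      two ℚ.* (B k ℚ.* invFact k ℚ.* (½ ℚ.* q ℚ.* invFact (suc (s ∸ k))))
        ≡⟨ cong (λ z → two ℚ.* (B k ℚ.* invFact k ℚ.* (½ ℚ.* q ℚ.* invFact z))) (sym (ℕP.+-∸-assoc 1 k≤s)) ⟩
      two ℚ.* (B k ℚ.* invFact k ℚ.* (½ ℚ.* q ℚ.* invFact (suc s ∸ k)))
        ≡⟨ solve 4 (λ b x q y → con two :* (b :* x :* (con ½ :* q :* y)) := (x :* y) :* q :* b) refl (B k) (invFact k) q (invFact (suc s ∸ k)) ⟩
      (invFact k ℚ.* invFact (suc s ∸ k)) ℚ.* q ℚ.* B k
        ≡⟨ cong (λ z → z ℚ.* q ℚ.* B k) (sym (choose*invFact (suc s) k (ℕP.m≤n⇒m≤1+n k≤s))) ⟩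
      (ℕ→ℚ (suc s C k) ℚ.* invFact (suc s)) ℚ.* q ℚ.* B k
        ≡⟨ cong (λ z → (ℕ→ℚ (suc s C k) ℚ.* z) ℚ.* q ℚ.* B k) (invFact-suc s) ⟩
      (ℕ→ℚ (suc s C k) ℚ.* (invSuc s ℚ.* invFact s)) ℚ.* q ℚ.* B k
        ≡⟨ solve 5 (λ c i f q b → (c :* (i :* f)) :* q :* b := i :* f :* (c :* q :* b)) refl (ℕ→ℚ (suc s C k)) (invSuc s) (invFact s) q (B k) ⟩
      invSuc s ℚ.* invFact s ℚ.* g k ∎
      where
      q = qpow ½ (s ∸ k)
      k≤s : k ≤ s
      k≤s = ℕP.m≤n⇒m≤1+n k≤

-- Each follows from β·V·(1 + e^{t/2}) = 1 and properties of e^{t/2}: the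
-- claimed series, multiplied by a factor with invertible constant term, is a
-- polynomial combination of these known relations (checked by the ring solver).
module GeneratingFunctions where

  open Scalars
  open PowerSeries
  open PowerSeries.SeriesSolver using (solve; _:+_; _:*_; :-_; _:=_; con)
  open SeriesOperators
  open Exponential
  open BernoulliRecursions using (β; β-defining-series)
  open import Algebra.Bundles using (CommutativeRing)
  open import Relation.Binary.Reasoning.Setoid (CommutativeRing.setoid series-commutativeRing)

  β-defining : β *s V *s (1s +s e^½t) ≈ 1s
  β-defining = begin
    β *s V *s (1s +s e^½t) ≈⟨ *cong {β *s V} (λ n → refl) (+cong {1s} (λ n → refl) e^½t-split) ⟩
    β *s V *s (1s +s (1s +s X *s V)) ≈⟨ solve 3 (λ b v t → b :* v :* (con 1ℚ :+ (con 1ℚ :+ t :* v)) := b :* (v :* (con two :+ t :* v))) (λ n → refl) β V X ⟩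
    β *s (V *s (cst two +s X *s V)) ≈⟨ *cong {β} (λ n → refl) (≈sym shift-e^t) ⟩
    β *s shift e^t ≈⟨ β-defining-series ⟩
    1s ∎

  β-defining₀ : β *s V *s (1s +s e^½t) +s -s 1s ≈ 0s
  β-defining₀ = diff-zero β-defining

  e^½t-split₀ : e^½t +s -s (1s +s X *s V) ≈ 0s
  e^½t-split₀ = diff-zero e^½t-split

  θ-1s+ : ∀ f → θ (1s +s f) ≈ θ f
  θ-1s+ f n = trans (θ-+ 1s f n) (trans (cong (ℚ._+ θ f n) (θ-cst 1ℚ n)) (ℚP.+-identityˡ _))

  -- θV = e^{t/2}/2 - V, from θ(1 + tV) = (t/2)·e^{t/2}.
  θV : θ V ≈ cst ½ *s e^½t +s -s V
  θV = X-cancel (zero-diff (≈trans (solve 4 (λ t dv u v → t :* dv :+ :- (t :* (con ½ :* u :+ :- v)) := (t :* dv :+ v :* t) :+ :- (con ½ :* (t :* u))) (λ n → refl) X (θ V) e^½t V) (diff-zero lem)))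
    where
    lem : X *s θ V +s V *s X ≈ cst ½ *s (X *s e^½t)
    lem = begin
      X *s θ V +s V *s X ≈⟨ solve 3 (λ t dv v → t :* dv :+ v :* t := t :* v :+ t :* dv) (λ n → refl) X (θ V) V ⟩
      X *s V +s X *s θ V ≈⟨ +cong (*cong (≈sym θX) (λ n → refl)) (λ n → refl) ⟩
      θ X *s V +s X *s θ V ≈⟨ ≈sym (θ-leibniz X V) ⟩
      θ (X *s V) ≈⟨ ≈sym (θ-1s+ (X *s V)) ⟩
      θ (1s +s X *s V) ≈⟨ θ-cong (≈sym e^½t-split) ⟩
      θ e^½t ≈⟨ θe^½t ⟩
      cst ½ *s (X *s e^½t) ∎

  -- θ applied to β·V·(1 + e^{t/2}) = 1, with θV and θe^{t/2} substituted.
  θβ-equation : (θ β *s V +s β *s (cst ½ *s e^½t +s -s V)) *s (1s +s e^½t) +s β *s V *s (cst ½ *s (X *s e^½t)) ≈ 0s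
  θβ-equation = begin
    (θ β *s V +s β *s (cst ½ *s e^½t +s -s V)) *s (1s +s e^½t) +s β *s V *s (cst ½ *s (X *s e^½t))
      ≈⟨ ≈sym (+cong (*cong (+cong {θ β *s V} (λ n → refl) (*cong {β} (λ n → refl) θV)) (λ n → refl)) (*cong {β *s V} (λ n → refl) (≈trans (θ-1s+ e^½t) θe^½t))) ⟩
    (θ β *s V +s β *s θ V) *s (1s +s e^½t) +s β *s V *s θ (1s +s e^½t)
      ≈⟨ ≈sym (+cong (*cong (θ-leibniz β V) (λ n → refl)) (λ n → refl)) ⟩
    θ (β *s V) *s (1s +s e^½t) +s β *s V *s θ (1s +s e^½t)
      ≈⟨ ≈sym (θ-leibniz (β *s V) (1s +s e^½t)) ⟩
    θ (β *s V *s (1s +s e^½t)) ≈⟨ θ-cong β-defining ⟩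
    θ 1s ≈⟨ θ-cst 1ℚ ⟩
    0s ∎

  -- E(t) = (t/2)·coth(t/2) and O(t) = 1 - 2β(t)·V(t).
  E : Series
  E = β +s cst ½ *s X

  O : Series
  O = 1s +s -s (cst two *s (β *s V))

  β-riccati : β *s β +s X *s β +s -s β +s θ β ≈ 0s
  β-riccati = cancel-factor _ (V *s (1s +s e^½t) *s (V *s (1s +s e^½t))) 1ℚ 1ℚ refl refl (≈trans
    (solve 5 (λ b d v u t → (b :* b :+ t :* b :+ :- b :+ d) :* (v :* (con 1ℚ :+ u) :* (v :* (con 1ℚ :+ u)))
       := (v :* (con 1ℚ :+ u)) :* ((b :+ t :+ :- con 1ℚ) :* (b :* v :* (con 1ℚ :+ u) :+ :- con 1ℚ) :+ ((d :* v :+ b :* (con ½ :* u :+ :- v)) :* (con 1ℚ :+ u) :+ b :* v :* (con ½ :* (t :* u))))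
          :+ (con 1ℚ :+ :- ((con ½ :* u :+ :- v) :* (con 1ℚ :+ u)) :+ :- (con ½ :* (t :* u) :* v)) :* (b :* v :* (con 1ℚ :+ u) :+ :- con 1ℚ)
          :+ :- ((con 1ℚ :+ con ½ :* u) :* (u :+ :- (con 1ℚ :+ t :* v))))
       (λ n → refl) β (θ β) V e^½t X)
    (+-zero (+-zero (*-zero (V *s (1s +s e^½t)) (+-zero (*-zero (β +s X +s -s 1s) β-defining₀) θβ-equation)) (*-zero (1s +s -s ((cst ½ *s e^½t +s -s V) *s (1s +s e^½t)) +s -s (cst ½ *s (X *s e^½t) *s V)) β-defining₀)) (neg-zero (*-zero (1s +s cst ½ *s e^½t) e^½t-split₀))))

  O-equation₀ : (1s +s -s (cst two *s (β *s V))) *s (β +s cst ½ *s X) +s -s (cst ½ *s X)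
                  +s -s (cst two *s (θ β *s V +s β *s (cst ½ *s e^½t +s -s V))) ≈ 0s
  O-equation₀ = cancel-factor _ (1s +s e^½t) two ½ refl refl (≈trans
    (solve 5 (λ b d v u t → ((con 1ℚ :+ :- (con two :* (b :* v))) :* (b :+ con ½ :* t) :+ :- (con ½ :* t) :+ :- (con two :* (d :* v :+ b :* (con ½ :* u :+ :- v)))) :* (con 1ℚ :+ u)
       := b :* (u :+ :- (con 1ℚ :+ t :* v)) :+ :- ((con two :* b) :* (b :* v :* (con 1ℚ :+ u) :+ :- con 1ℚ)) :+ :- (con two :* ((d :* v :+ b :* (con ½ :* u :+ :- v)) :* (con 1ℚ :+ u) :+ b :* v :* (con ½ :* (t :* u)))))
       (λ n → refl) β (θ β) V e^½t X)
    (+-zero (+-zero (*-zero β e^½t-split₀) (neg-zero (*-zero (cst two *s β) β-defining₀))) (neg-zero (*-zero (cst two) θβ-equation))))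

  scale-β-defining : ∀ c → scale c β *s scale c V *s (1s +s scale c e^½t) ≈ 1s
  scale-β-defining c = begin
    scale c β *s scale c V *s (1s +s scale c e^½t) ≈⟨ *cong (≈sym (scale-* c β V)) (≈sym (scale-1s+ c e^½t)) ⟩
    scale c (β *s V) *s scale c (1s +s e^½t) ≈⟨ ≈sym (scale-* c (β *s V) (1s +s e^½t)) ⟩
    scale c (β *s V *s (1s +s e^½t)) ≈⟨ scale-cong c β-defining ⟩
    scale c 1s ≈⟨ scale-cst c 1ℚ ⟩
    1s ∎

  scale-e^½t-split : ∀ c → scale c e^½t ≈ 1s +s (cst c *s X) *s scale c V
  scale-e^½t-split c = begin
    scale c e^½t ≈⟨ scale-cong c e^½t-split ⟩
    scale c (1s +s X *s V) ≈⟨ scale-1s+ c (X *s V) ⟩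
    1s +s scale c (X *s V) ≈⟨ +cong {1s} (λ n → refl) (≈trans (scale-* c X V) (*cong (scale-X c) (λ n → refl))) ⟩
    1s +s (cst c *s X) *s scale c V ∎

  scale2-e^½t-square : scale two e^½t ≈ e^½t *s e^½t
  scale2-e^½t-square = ≈trans scale2-e^½t (≈sym e^½t²)

  -- e^{-t/2}·e^{t/2} = 1, since θ kills the product.
  e^-½t*e^½t : scale neg1 e^½t *s e^½t ≈ 1s
  e^-½t*e^½t = ≈trans (θ-zero-constant (scale neg1 e^½t *s e^½t) th) (λ { zero → refl ; (suc n) → refl })
    where
    dN : θ (scale neg1 e^½t) ≈ cst ½ *s ((cst neg1 *s X) *s scale neg1 e^½t)
    dN = begin
      θ (scale neg1 e^½t) ≈⟨ θ-scale neg1 e^½t ⟩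
      scale neg1 (θ e^½t) ≈⟨ scale-cong neg1 θe^½t ⟩
      scale neg1 (cst ½ *s (X *s e^½t)) ≈⟨ ≈trans (scale-* neg1 (cst ½) (X *s e^½t)) (*cong (scale-cst neg1 ½) (≈trans (scale-* neg1 X e^½t) (*cong (scale-X neg1) (λ n → refl)))) ⟩
      cst ½ *s ((cst neg1 *s X) *s scale neg1 e^½t) ∎
    th : θ (scale neg1 e^½t *s e^½t) ≈ 0s
    th = begin
      θ (scale neg1 e^½t *s e^½t) ≈⟨ θ-leibniz (scale neg1 e^½t) e^½t ⟩
      θ (scale neg1 e^½t) *s e^½t +s scale neg1 e^½t *s θ e^½t ≈⟨ +cong (*cong dN (λ n → refl)) (*cong {scale neg1 e^½t} (λ n → refl) θe^½t) ⟩
      cst ½ *s ((cst neg1 *s X) *s scale neg1 e^½t) *s e^½t +s scale neg1 e^½t *s (cst ½ *s (X *s e^½t))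
        ≈⟨ solve 3 (λ t a u → con ½ :* ((con neg1 :* t) :* a) :* u :+ a :* (con ½ :* (t :* u)) := con 0ℚ) (λ n → refl) X (scale neg1 e^½t) e^½t ⟩
      cst 0ℚ ≈⟨ (λ { zero → refl ; (suc n) → refl }) ⟩
      0s ∎

  β-reflection : scale neg1 β +s -s β +s -s X ≈ 0s
  β-reflection = cancel-X-factor _ (scale neg1 V *s (1s +s scale neg1 e^½t) *s (e^½t *s e^½t)) 1ℚ 1ℚ refl refl (≈trans
    (solve 7 (λ b v u b' v' u' t → t :* ((b' :+ :- b :+ :- t) :* (v' :* (con 1ℚ :+ u') :* (u :* u)))
       := (t :* (u :* u)) :* (b' :* v' :* (con 1ℚ :+ u') :+ :- con 1ℚ)
          :+ :- (((b :+ t) :* (con 1ℚ :+ u') :* (u :* u)) :* (u' :+ :- (con 1ℚ :+ (con neg1 :* t) :* v')))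
          :+ :- (t :* (b :* v :* (con 1ℚ :+ u) :+ :- con 1ℚ))
          :+ :- ((b :* (con 1ℚ :+ u)) :* (u :+ :- (con 1ℚ :+ t :* v)))
          :+ ((b :+ t) :* (con two :+ (u' :* u :+ :- con 1ℚ))) :* (u' :* u :+ :- con 1ℚ))
       (λ n → refl) β V e^½t (scale neg1 β) (scale neg1 V) (scale neg1 e^½t) X)
    (+-zero (+-zero (+-zero (+-zero (*-zero (X *s (e^½t *s e^½t)) (diff-zero (scale-β-defining neg1))) (neg-zero (*-zero ((β +s X) *s (1s +s scale neg1 e^½t) *s (e^½t *s e^½t)) (diff-zero (scale-e^½t-split neg1))))) (neg-zero (*-zero X β-defining₀))) (neg-zero (*-zero (β *s (1s +s e^½t)) e^½t-split₀)))
       (*-zero ((β +s X) *s (cst two +s (scale neg1 e^½t *s e^½t +s -s 1s))) (diff-zero e^-½t*e^½t))))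

  O-reflection₀ : 1s +s -s (cst two *s (scale neg1 β *s scale neg1 V)) +s (1s +s -s (cst two *s (β *s V))) ≈ 0s
  O-reflection₀ = cancel-factor _ ((1s +s e^½t) *s (1s +s scale neg1 e^½t)) (+ 4 ℚ./ 1) ¼ refl refl (≈trans
    (solve 6 (λ b v u b' v' u' → (con 1ℚ :+ :- (con two :* (b' :* v')) :+ (con 1ℚ :+ :- (con two :* (b :* v)))) :* ((con 1ℚ :+ u) :* (con 1ℚ :+ u'))
       := con two :* (u' :* u :+ :- con 1ℚ) :+ :- ((con two :* (con 1ℚ :+ u)) :* (b' :* v' :* (con 1ℚ :+ u') :+ :- con 1ℚ))
          :+ :- ((con two :* (con 1ℚ :+ u')) :* (b :* v :* (con 1ℚ :+ u) :+ :- con 1ℚ)))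
       (λ n → refl) β V e^½t (scale neg1 β) (scale neg1 V) (scale neg1 e^½t))
    (+-zero (+-zero (*-zero (cst two) (diff-zero e^-½t*e^½t)) (neg-zero (*-zero (cst two *s (1s +s e^½t)) (diff-zero (scale-β-defining neg1))))) (neg-zero (*-zero (cst two *s (1s +s scale neg1 e^½t)) β-defining₀))))

  E-duplication-O₀ : scale two β +s -s β +s X *s scale two β *s scale two V ≈ 0s
  E-duplication-O₀ = cancel-X-factor _ (scale two V *s (1s +s scale two e^½t)) 1ℚ 1ℚ refl refl (≈trans
    (solve 7 (λ b v u p q w t → t :* ((p :+ :- b :+ t :* p :* q) :* (q :* (con 1ℚ :+ w)))
       := (t :* (con 1ℚ :+ t :* q)) :* (p :* q :* (con 1ℚ :+ w) :+ :- con 1ℚ)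
          :+ :- ((con 1ℚ :+ t :* q) :* (t :* (b :* v :* (con 1ℚ :+ u) :+ :- con 1ℚ) :+ (b :* (u :+ con 1ℚ)) :* (u :+ :- (con 1ℚ :+ t :* v)) :+ b :* (w :+ :- (u :* u)) :+ :- (b :* (w :+ :- (con 1ℚ :+ (con two :* t) :* q)))))
          :+ :- ((t :* b :* q) :* (w :+ :- (con 1ℚ :+ (con two :* t) :* q))))
       (λ n → refl) β V e^½t (scale two β) (scale two V) (scale two e^½t) X)
    (+-zero (+-zero (*-zero (X *s (1s +s X *s scale two V)) (diff-zero (scale-β-defining two)))
            (neg-zero (*-zero (1s +s X *s scale two V) (+-zero (+-zero (+-zero (*-zero X β-defining₀) (*-zero (β *s (e^½t +s 1s)) e^½t-split₀)) (*-zero β (diff-zero scale2-e^½t-square))) (neg-zero (*-zero β (diff-zero (scale-e^½t-split two))))))))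
        (neg-zero (*-zero (X *s β *s scale two V) (diff-zero (scale-e^½t-split two))))))

  O-duplication₀ : β +s -s (cst two *s (scale two β *s scale two V) *s β) +s -s (X *s (scale two β *s scale two V)) ≈ 0s
  O-duplication₀ = cancel-factor _ (1s +s scale two e^½t) two ½ refl refl (≈trans
    (solve 7 (λ b v u p q w t → (b :+ :- (con two :* (p :* q) :* b) :+ :- (t :* (p :* q))) :* (con 1ℚ :+ w)
       := t :* (b :* v :* (con 1ℚ :+ u) :+ :- con 1ℚ) :+ (b :* (u :+ con 1ℚ)) :* (u :+ :- (con 1ℚ :+ t :* v)) :+ b :* (w :+ :- (u :* u))
          :+ :- ((con two :* b :+ t) :* (p :* q :* (con 1ℚ :+ w) :+ :- con 1ℚ)))
       (λ n → refl) β V e^½t (scale two β) (scale two V) (scale two e^½t) X)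
    (+-zero (+-zero (+-zero (*-zero X β-defining₀) (*-zero (β *s (e^½t +s 1s)) e^½t-split₀)) (*-zero β (diff-zero scale2-e^½t-square))) (neg-zero (*-zero (cst two *s β +s X) (diff-zero (scale-β-defining two))))))

  scale-E : ∀ c → scale c E ≈ scale c β +s cst ½ *s (cst c *s X)
  scale-E c = ≈trans (scale-+ c β (cst ½ *s X)) (+cong {scale c β} (λ n → refl) (≈trans (scale-* c (cst ½) X) (*cong (scale-cst c ½) (scale-X c))))

  scale-O : ∀ c → scale c O ≈ 1s +s -s (cst two *s (scale c β *s scale c V))
  scale-O c = ≈trans (scale-+ c 1s (-s (cst two *s (β *s V)))) (+cong (scale-cst c 1ℚ)
    (≈trans (scale-neg c (cst two *s (β *s V))) (λ n → cong ℚ.-_ (≈trans (scale-* c (cst two) (β *s V)) (*cong (scale-cst c two) (scale-* c β V)) n))))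

  E-even : scale neg1 E +s -s E ≈ 0s
  E-even = ≈trans (+cong (scale-E neg1) (λ n → refl))
    (≈trans (solve 3 (λ b' b t → (b' :+ con ½ :* (con neg1 :* t)) :+ :- (b :+ con ½ :* t) := b' :+ :- b :+ :- t) (λ n → refl) (scale neg1 β) β X) β-reflection)

  O-odd : scale neg1 O +s O ≈ 0s
  O-odd = ≈trans (+cong (scale-O neg1) (λ n → refl)) O-reflection₀

  θE : θ E ≈ θ β +s cst ½ *s X
  θE = ≈trans (θ-+ β (cst ½ *s X)) (+cong {θ β} (λ n → refl) (≈trans (θ-const* ½ X) (*cong {cst ½} (λ n → refl) θX)))

  θβV : θ (β *s V) ≈ θ β *s V +s β *s (cst ½ *s e^½t +s -s V)
  θβV = ≈trans (θ-leibniz β V) (+cong {θ β *s V} (λ n → refl) (*cong {β} (λ n → refl) θV))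

  θO : θ O ≈ -s (cst two *s (θ β *s V +s β *s (cst ½ *s e^½t +s -s V)))
  θO = ≈trans (θ-+ 1s (-s (cst two *s (β *s V))))
    (λ n → trans (cong₂ ℚ._+_ (θ-cst 1ℚ n) (θ-neg (cst two *s (β *s V)) n)) (trans (ℚP.+-identityˡ _)
       (cong ℚ.-_ (≈trans (θ-const* two (β *s V)) (*cong {cst two} (λ n → refl) θβV) n))))

  E-riccati : E *s E +s -s E +s θ E +s -s (cst ¼ *s (X *s X)) ≈ 0s
  E-riccati = ≈trans (+cong (+cong {E *s E +s -s E} (λ n → refl) θE) (λ n → refl)) (≈trans
    (solve 4 (λ b d t h → (b :+ con ½ :* t) :* (b :+ con ½ :* t) :+ :- (b :+ con ½ :* t) :+ (d :+ con ½ :* t) :+ :- (con ¼ :* (t :* t))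
       := b :* b :+ t :* b :+ :- b :+ d) (λ n → refl) β (θ β) X X) β-riccati)

  O-equation : O *s E +s -s (cst ½ *s X) +s θ O ≈ 0s
  O-equation = ≈trans (+cong {O *s E +s -s (cst ½ *s X)} (λ n → refl) θO) O-equation₀

  E-duplication-O : scale two E +s -s E +s -s (cst ½ *s X *s scale two O) ≈ 0s
  E-duplication-O = ≈trans (+cong (+cong (scale-E two) (λ n → refl)) (λ n → cong ℚ.-_ (*cong {cst ½ *s X} (λ n → refl) (scale-O two) n)))
    (≈trans (solve 5 (λ p b q t o → (p :+ con ½ :* (con two :* t)) :+ :- (b :+ con ½ :* t) :+ :- (con ½ :* t :* (con 1ℚ :+ :- (con two :* (p :* q))))
       := p :+ :- b :+ t :* p :* q) (λ n → refl) (scale two β) β (scale two V) X X) E-duplication-O₀)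

  O-duplication : scale two O *s E +s -s (cst ½ *s X) ≈ 0s
  O-duplication = ≈trans (+cong (*cong (scale-O two) (λ n → refl)) (λ n → refl))
    (≈trans (solve 4 (λ p q b t → (con 1ℚ :+ :- (con two :* (p :* q))) :* (b :+ con ½ :* t) :+ :- (con ½ :* t)
       := b :+ :- (con two :* (p :* q) :* b) :+ :- (t :* (p :* q))) (λ n → refl) (scale two β) (scale two V) β X) O-duplication₀)

  E-duplication : scale two E *s E +s -s (E *s E) +s -s (cst ¼ *s (X *s X)) ≈ 0s
  E-duplication = ≈trans (solve 5 (λ p e o t x → p :* e :+ :- (e :* e) :+ :- (con ¼ :* (t :* t))
          := e :* (p :+ :- e :+ :- (con ½ :* t :* o)) :+ (con ½ :* t) :* (o :* e :+ :- (con ½ :* t))) (λ n → refl) (scale two E) E (scale two O) X X)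
    (+-zero (*-zero E E-duplication-O) (*-zero (cst ½ *s X) O-duplication))

  scale½-scale2 : ∀ f → scale ½ (scale two f) ≈ f
  scale½-scale2 f = ≈trans (scale-scale ½ two f) (scale-1 f)

  scale½-½X : scale ½ (cst ½ *s X) ≈ cst ½ *s (cst ½ *s X)
  scale½-½X = ≈trans (scale-* ½ (cst ½) X) (*cong (scale-cst ½ ½) (scale-X ½))

  O-halving : O *s scale ½ E +s -s (cst ½ *s (cst ½ *s X)) ≈ 0s
  O-halving = ≈trans (≈sym (+cong (*cong (scale½-scale2 O) (λ n → refl)) (λ n → cong ℚ.-_ (scale½-½X n))))
    (≈trans (≈sym (+cong (scale-* ½ (scale two O) E) (scale-neg ½ (cst ½ *s X)))) (≈trans (≈sym (scale-+ ½ _ _)) (scale-zero ½ O-duplication)))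

  E-halving-O : E +s -s scale ½ E +s -s (cst ¼ *s (X *s O)) ≈ 0s
  E-halving-O = ≈trans (+cong {E +s -s scale ½ E} (λ n → refl)
      (λ n → cong ℚ.-_ (solve 2 (λ t o → con ¼ :* (t :* o) := con ½ :* (con ½ :* t) :* o) (λ n → refl) X O n)))
    (≈trans (≈sym (+cong (+cong (scale½-scale2 E) (scale-neg ½ E)) (λ n → cong ℚ.-_ (≈trans (scale-* ½ (cst ½ *s X) (scale two O)) (*cong scale½-½X (scale½-scale2 O)) n))))
    (≈trans (≈sym (+cong (scale-+ ½ _ _) (scale-neg ½ (cst ½ *s X *s scale two O)))) (≈trans (≈sym (scale-+ ½ _ _)) (scale-zero ½ E-duplication-O))))

  E-halving : E *s scale ½ E +s -s scale ½ (E *s E) +s -s scale ½ (cst ¼ *s (X *s X)) ≈ 0s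
  E-halving = ≈trans (≈sym (+cong (+cong (≈trans (scale-* ½ (scale two E) E) (*cong (scale½-scale2 E) (λ n → refl))) (scale-neg ½ (E *s E))) (scale-neg ½ (cst ¼ *s (X *s X)))))
    (≈trans (≈sym (+cong (scale-+ ½ _ _) (λ n → refl))) (≈trans (≈sym (scale-+ ½ _ _)) (scale-zero ½ E-duplication)))

module Coefficients where

  open Scalars
  open PowerSeries
  open SeriesOperators
  open Exponential using (V)
  open BernoulliRecursions using (β; B*-β-V; B′-B)
  open GeneratingFunctions
  open import Data.Rational.Solver
  open +-*-Solver using (solve; _:+_; _:*_; :-_; _:=_; con)

  const*-coeff : ∀ c f n → (cst c *s f) n ≡ c ℚ.* f n
  const*-coeff c f n = sym (const-scalar c f n)

  E-odd-coeff : ∀ k → E (suc (2 ℕ.* k)) ≡ 0ℚ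
  E-odd-coeff k = zero-by-inverse two ½ x refl (trans (solve 1 (λ x → x :* con two := :- (con neg1 :* con 1ℚ :* x :+ :- x)) refl x)
     (cong ℚ.-_ (trans (cong (λ z → neg1 ℚ.* z ℚ.* x ℚ.+ ℚ.- x) (sym (neg1^even k))) (E-even (suc (2 ℕ.* k))))))
    where
    x = E (suc (2 ℕ.* k))

  O-even-coeff : ∀ k → O (2 ℕ.* k) ≡ 0ℚ
  O-even-coeff k = zero-by-inverse two ½ x refl (trans (solve 1 (λ x → x :* con two := con 1ℚ :* x :+ x) refl x)
     (trans (cong (λ z → z ℚ.* x ℚ.+ x) (sym (neg1^even k))) (O-odd (2 ℕ.* k))))
    where
    x = O (2 ℕ.* k)

  ½X-coeff : ∀ m → (cst ½ *s X) (suc (suc m)) ≡ 0ℚ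
  ½X-coeff m = trans (const*-coeff ½ X (suc (suc m))) (ℚP.*-zeroʳ ½)

  ¼X²-coeff : ∀ m → (cst ¼ *s (X *s X)) (suc (suc (suc m))) ≡ 0ℚ
  ¼X²-coeff m = trans (const*-coeff ¼ (X *s X) (suc (suc (suc m)))) (trans (cong (¼ ℚ.*_) (X* X (suc (suc (suc m))))) (ℚP.*-zeroʳ ¼))

  E-coeff-β : ∀ m → E (suc (suc m)) ≡ β (suc (suc m))
  E-coeff-β m = trans (cong (β (suc (suc m)) ℚ.+_) (½X-coeff m)) (ℚP.+-identityʳ _)

  E-even-coeff-β : ∀ j → E (2 ℕ.* j) ≡ β (2 ℕ.* j)
  E-even-coeff-β zero = refl
  E-even-coeff-β (suc j) = trans (cong E (ℕP.*-suc 2 j)) (trans (E-coeff-β (2 ℕ.* j)) (cong β (sym (ℕP.*-suc 2 j))))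

  B*-coeff : ∀ n → B* n ℚ.* invFact n ≡ E n ℚ.+ O n
  B*-coeff zero = refl
  B*-coeff (suc zero) = refl
  B*-coeff (suc (suc r)) = trans (B*-β-V r) (sym (trans (cong₂ ℚ._+_ (E-coeff-β r) (cong (λ z → 0ℚ ℚ.+ ℚ.- z) (const*-coeff two (β *s V) (suc (suc r)))))
     (cong (β (suc (suc r)) ℚ.+_) (ℚP.+-identityˡ _))))

  B′-coeff : ∀ k → B′ (2 ℕ.* k) ℚ.* invFact (2 ℕ.* k) ≡ qpow ½ (2 ℕ.* k) ℚ.* E (2 ℕ.* k)
  B′-coeff zero = refl
  B′-coeff (suc j) = subst (λ m → B′ m ℚ.* invFact m ≡ qpow ½ m ℚ.* E m) (sym (ℕP.*-suc 2 j))
    (trans (cong (ℚ._* invFact n) (B′-B (suc (2 ℕ.* j))))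
    (trans (ℚP.*-assoc (qpow ½ n) (B n) (invFact n)) (cong (qpow ½ n ℚ.*_) (sym (E-coeff-β (2 ℕ.* j))))))
    where n = suc (suc (2 ℕ.* j))

  coeff-E² : ∀ m → let n = suc (suc (suc m)) in conv E E n ≡ E n ℚ.+ ℚ.- (ℕ→ℚ n ℚ.* E n)
  coeff-E² m = diff-zero-ℚ _ _ (trans (solve 4 (λ a b c d → a :+ :- (b :+ :- c) := a :+ :- b :+ c :+ :- d :+ d) refl
     (conv E E n) (E n) (ℕ→ℚ n ℚ.* E n) d) (trans (cong₂ ℚ._+_ (E-riccati n) (¼X²-coeff m)) refl))
    where
    n = suc (suc (suc m))
    d = (cst ¼ *s (X *s X)) n

  coeff-E-duplication : ∀ m → let n = suc (suc (suc m)) in conv (scale two E) E n ≡ conv E E n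
  coeff-E-duplication m = diff-zero-ℚ _ _ (trans (solve 3 (λ a b d → a :+ :- b := a :+ :- b :+ :- d :+ d) refl
     (conv (scale two E) E n) (conv E E n) d) (trans (cong₂ ℚ._+_ (E-duplication n) (¼X²-coeff m)) refl))
    where
    n = suc (suc (suc m))
    d = (cst ¼ *s (X *s X)) n

  coeff-E-halving : ∀ m → let n = suc (suc (suc m)) in conv E (scale ½ E) n ≡ qpow ½ n ℚ.* conv E E n
  coeff-E-halving m = diff-zero-ℚ _ _ (trans (solve 4 (λ a b q d → a :+ :- b := a :+ :- b :+ :- (q :* d) :+ q :* d) refl
     (conv E (scale ½ E) n) (qpow ½ n ℚ.* conv E E n) (qpow ½ n) d) (trans (cong₂ ℚ._+_ (E-halving n) (trans (cong (qpow ½ n ℚ.*_) (¼X²-coeff m)) (ℚP.*-zeroʳ (qpow ½ n)))) refl))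
    where
    n = suc (suc (suc m))
    d = (cst ¼ *s (X *s X)) n

  coeff-OE : ∀ m → let n = suc (suc m) in conv O E n ≡ ℚ.- (ℕ→ℚ n ℚ.* O n)
  coeff-OE m = diff-zero-ℚ _ _ (trans (solve 3 (λ a c d → a :+ :- (:- c) := a :+ :- d :+ c :+ d) refl
     (conv O E n) (ℕ→ℚ n ℚ.* O n) d) (trans (cong₂ ℚ._+_ (O-equation n) (½X-coeff m)) refl))
    where
    n = suc (suc m)
    d = (cst ½ *s X) n

  coeff-O-halving : ∀ m → conv O (scale ½ E) (suc (suc m)) ≡ 0ℚ
  coeff-O-halving m = trans (solve 2 (λ a d → a := a :+ :- d :+ d) refl (conv O (scale ½ E) n) d)
    (trans (cong₂ ℚ._+_ (O-halving n) (trans (const*-coeff ½ (cst ½ *s X) n) (trans (cong (½ ℚ.*_) (½X-coeff m)) (ℚP.*-zeroʳ ½)))) refl)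
    where
    n = suc (suc m)
    d = (cst ½ *s (cst ½ *s X)) n

  coeff-E-halving-O : ∀ m → E (suc m) ℚ.+ ℚ.- (qpow ½ (suc m) ℚ.* E (suc m)) ≡ ¼ ℚ.* O m
  coeff-E-halving-O m = trans (solve 2 (λ a d → a := a :+ :- d :+ d) refl (E n ℚ.+ ℚ.- (qpow ½ n ℚ.* E n)) d)
    (trans (cong₂ ℚ._+_ (E-halving-O n) coeff-d) (ℚP.+-identityˡ _))
    where
    n = suc m
    d = (cst ¼ *s (X *s O)) n
    coeff-d : d ≡ ¼ ℚ.* O m
    coeff-d = trans (const*-coeff ¼ (X *s O) n) (cong (¼ ℚ.*_) (X* O n))

module Evaluation where

  open FiniteSums
  open import Data.Rational.Solver
  open +-*-Solver using (solve; _:+_; _:*_; :-_; _:=_; con)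

  ι-* : ∀ a b → ι a ⊗ ι b ≡ ι (a ℚ.* b)
  ι-* a b = cong₂ _+i_ (solve 2 (λ a b → a :* b :+ :- (con 0ℚ :* con 0ℚ) := a :* b) refl a b)
                       (solve 2 (λ a b → a :* con 0ℚ :+ con 0ℚ :* b := con 0ℚ) refl a b)

  cpow-ι : ∀ q m → cpow (ι q) m ≡ ι (qpow q m)
  cpow-ι q zero = refl
  cpow-ι q (suc m) = trans (cong (ι q ⊗_) (cpow-ι q m)) (ι-* q (qpow q m))

  cpow-imaginary : ∀ c k → cpow (0ℚ +i c) (2 ℕ.* k) ≡ ι (qpow (ℚ.- (c ℚ.* c)) k)
  cpow-imaginary c zero = refl
  cpow-imaginary c (suc k) = trans (cong (cpow z) (ℕP.*-suc 2 k)) (trans (cong (λ w → z ⊗ (z ⊗ w)) (cpow-imaginary c k)) (cong₂ _+i_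
    (solve 2 (λ c r → con 0ℚ :* (con 0ℚ :* r :+ :- (c :* con 0ℚ)) :+ :- (c :* (con 0ℚ :* con 0ℚ :+ c :* r)) := :- (c :* c) :* r) refl c r)
    (solve 2 (λ c r → con 0ℚ :* (con 0ℚ :* con 0ℚ :+ c :* r) :+ c :* (con 0ℚ :* r :+ :- (c :* con 0ℚ)) := con 0ℚ) refl c r)))
    where
    r = qpow (ℚ.- (c ℚ.* c)) k
    z = 0ℚ +i c

  sum-ι : ∀ n g → sumTo _⊕_ n (λ k → ι (g k)) ≡ ι (Σ n g)
  sum-ι zero g = refl
  sum-ι (suc n) g = cong (_⊕ ι (g (suc n))) (sum-ι n g)

  sum-cong⊕ : ∀ n {f g : ℕ → ℚi} → (∀ k → f k ≡ g k) → sumTo _⊕_ n f ≡ sumTo _⊕_ n g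
  sum-cong⊕ zero p = p 0
  sum-cong⊕ (suc n) p = cong₂ _⊕_ (sum-cong⊕ n p) (p (suc n))

  oddCoeff : ℕ → ℕ → ℚ
  oddCoeff s k = B (2 ℕ.* k) ℚ.* B (2 ℕ.* s ℕ.+ 2 ℕ.∸ 2 ℕ.* k) ℚ.* invFact (2 ℕ.* k) ℚ.* invFact (2 ℕ.* s ℕ.+ 2 ℕ.∸ 2 ℕ.* k)

  evenCoeff : ℕ → ℕ → ℚ
  evenCoeff s k = B* (2 ℕ.* s ℕ.+ 1 ℕ.∸ 2 ℕ.* k) ℚ.* B* (2 ℕ.* k) ℚ.* invFact (2 ℕ.* s ℕ.+ 1 ℕ.∸ 2 ℕ.* k) ℚ.* invFact (2 ℕ.* k)

  Rodd-at : ∀ s (z : ℚi) (g : ℕ → ℚ) → (∀ k → cpow z (2 ℕ.* k) ≡ ι (g k)) → Rodd s z ≡ ι (Σ (suc s) (λ k → oddCoeff s k ℚ.* g k))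
  Rodd-at s z g p = trans (sum-cong⊕ (suc s) (λ k → trans (cong (ι (oddCoeff s k) ⊗_) (p k)) (ι-* (oddCoeff s k) (g k))))
    (sum-ι (suc s) (λ k → oddCoeff s k ℚ.* g k))

  Reven-at : ∀ s (z : ℚi) (g : ℕ → ℚ) → (∀ k → cpow z (2 ℕ.* k) ≡ ι (g k)) → Reven s z ≡ ι (Σ s (λ k → evenCoeff s k ℚ.* g k))
  Reven-at s z g p = trans (sum-cong⊕ s (λ k → trans (cong (ι (evenCoeff s k) ⊗_) (p k)) (ι-* (evenCoeff s k) (g k))))
    (sum-ι s (λ k → evenCoeff s k ℚ.* g k))

  Rodd-real : ∀ s q → Rodd s (ι q) ≡ ι (Σ (suc s) (λ k → oddCoeff s k ℚ.* qpow q (2 ℕ.* k)))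
  Rodd-real s q = Rodd-at s (ι q) (λ k → qpow q (2 ℕ.* k)) (λ k → cpow-ι q (2 ℕ.* k))

  Reven-real : ∀ s q → Reven s (ι q) ≡ ι (Σ s (λ k → evenCoeff s k ℚ.* qpow q (2 ℕ.* k)))
  Reven-real s q = Reven-at s (ι q) (λ k → qpow q (2 ℕ.* k)) (λ k → cpow-ι q (2 ℕ.* k))

  Rodd-imaginary : ∀ s c → Rodd s (0ℚ +i c) ≡ ι (Σ (suc s) (λ k → oddCoeff s k ℚ.* qpow (ℚ.- (c ℚ.* c)) k))
  Rodd-imaginary s c = Rodd-at s (0ℚ +i c) (qpow (ℚ.- (c ℚ.* c))) (cpow-imaginary c)

  Reven-imaginary : ∀ s c → Reven s (0ℚ +i c) ≡ ι (Σ s (λ k → evenCoeff s k ℚ.* qpow (ℚ.- (c ℚ.* c)) k))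
  Reven-imaginary s c = Reven-at s (0ℚ +i c) (qpow (ℚ.- (c ℚ.* c))) (cpow-imaginary c)

-- R_{2s+1}(q) is the coefficient of t^{2s+2} in E(qt)·E(t), and R_{2s}(q) that
-- of t^{2s+1} in E(qt)·O(t): the odd terms of E and even terms of O drop out.
module ProductCoefficients where

  open FiniteSums
  open PowerSeries
  open SeriesOperators using (scale)
  open BernoulliRecursions using (β)
  open GeneratingFunctions using (E; O)
  open Coefficients
  open Evaluation using (oddCoeff; evenCoeff)
  open import Data.Rational.Solver
  open +-*-Solver using (solve; _:*_; _:=_)

  2[1+s]≡2s+2 : ∀ s → 2 ℕ.* suc s ≡ 2 ℕ.* s ℕ.+ 2
  2[1+s]≡2s+2 s = trans (ℕP.*-suc 2 s) (ℕP.+-comm 2 (2 ℕ.* s))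

  1+2s≡2s+1 : ∀ s → suc (2 ℕ.* s) ≡ 2 ℕ.* s ℕ.+ 1
  1+2s≡2s+1 s = ℕP.+-comm 1 (2 ℕ.* s)

  1+2s∸2k≡1+2[s∸k] : ∀ s k → k ≤ s → suc (2 ℕ.* s) ∸ 2 ℕ.* k ≡ suc (2 ℕ.* (s ∸ k))
  1+2s∸2k≡1+2[s∸k] s k k≤s = trans (ℕP.+-∸-assoc 1 (ℕP.*-monoʳ-≤ 2 k≤s)) (cong suc (sym (ℕP.*-distribˡ-∸ 2 s k)))

  2s+1∸2k≡1+2[s∸k] : ∀ s k → k ≤ s → 2 ℕ.* s ℕ.+ 1 ∸ 2 ℕ.* k ≡ suc (2 ℕ.* (s ∸ k))
  2s+1∸2k≡1+2[s∸k] s k k≤s = trans (cong (_∸ 2 ℕ.* k) (sym (1+2s≡2s+1 s))) (1+2s∸2k≡1+2[s∸k] s k k≤s)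

  evenCoeff-OE : ∀ s k → k ≤ s → evenCoeff s k ≡ O (suc (2 ℕ.* (s ∸ k))) ℚ.* E (2 ℕ.* k)
  evenCoeff-OE s k k≤s = begin
    B* a ℚ.* B* b ℚ.* invFact a ℚ.* invFact b
      ≡⟨ solve 4 (λ x y z w → x :* y :* z :* w := (x :* z) :* (y :* w)) refl (B* a) (B* b) (invFact a) (invFact b) ⟩
    (B* a ℚ.* invFact a) ℚ.* (B* b ℚ.* invFact b)
      ≡⟨ cong₂ ℚ._*_ (trans (B*-coeff a) (trans (cong (λ z → E z ℚ.+ O z) (2s+1∸2k≡1+2[s∸k] s k k≤s)) (trans (cong (ℚ._+ O a') (E-odd-coeff (s ∸ k))) (ℚP.+-identityˡ (O a')))))
                     (trans (B*-coeff b) (trans (cong (E b ℚ.+_) (O-even-coeff k)) (ℚP.+-identityʳ (E b)))) ⟩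
    O a' ℚ.* E b ∎
    where
    open ≡-Reasoning
    a = 2 ℕ.* s ℕ.+ 1 ℕ.∸ 2 ℕ.* k
    a' = suc (2 ℕ.* (s ∸ k))
    b = 2 ℕ.* k

  oddCoeff-symmetric : ∀ s k → k ≤ suc s → oddCoeff s (suc s ∸ k) ≡ oddCoeff s k
  oddCoeff-symmetric s k k≤ = begin
    B (2 ℕ.* j) ℚ.* B (M ∸ 2 ℕ.* j) ℚ.* invFact (2 ℕ.* j) ℚ.* invFact (M ∸ 2 ℕ.* j)
      ≡⟨ cong₂ (λ x y → B x ℚ.* B y ℚ.* invFact x ℚ.* invFact y) 2j≡M∸2k M∸2j≡2k ⟩
    B (M ∸ 2 ℕ.* k) ℚ.* B (2 ℕ.* k) ℚ.* invFact (M ∸ 2 ℕ.* k) ℚ.* invFact (2 ℕ.* k)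
      ≡⟨ solve 4 (λ a b c d → a :* b :* c :* d := b :* a :* d :* c) refl (B (M ∸ 2 ℕ.* k)) (B (2 ℕ.* k)) (invFact (M ∸ 2 ℕ.* k)) (invFact (2 ℕ.* k)) ⟩
    oddCoeff s k ∎
    where
    open ≡-Reasoning
    j = suc s ∸ k
    M = 2 ℕ.* s ℕ.+ 2
    2j≡M∸2k : 2 ℕ.* j ≡ M ∸ 2 ℕ.* k
    2j≡M∸2k = trans (ℕP.*-distribˡ-∸ 2 (suc s) k) (cong (_∸ 2 ℕ.* k) (2[1+s]≡2s+2 s))
    M∸2j≡2k : M ∸ 2 ℕ.* j ≡ 2 ℕ.* k
    M∸2j≡2k = trans (cong (M ∸_) 2j≡M∸2k) (ℕP.m∸[m∸n]≡n (subst (2 ℕ.* k ≤_) (2[1+s]≡2s+2 s) (ℕP.*-monoʳ-≤ 2 k≤)))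

  scale-E-odd-term : ∀ q k x → scale q E (suc (2 ℕ.* k)) ℚ.* x ≡ 0ℚ
  scale-E-odd-term q k x = begin
    qpow q (suc (2 ℕ.* k)) ℚ.* E (suc (2 ℕ.* k)) ℚ.* x ≡⟨ cong (λ z → qpow q (suc (2 ℕ.* k)) ℚ.* z ℚ.* x) (E-odd-coeff k) ⟩
    qpow q (suc (2 ℕ.* k)) ℚ.* 0ℚ ℚ.* x ≡⟨ cong (ℚ._* x) (ℚP.*-zeroʳ (qpow q (suc (2 ℕ.* k)))) ⟩
    0ℚ ℚ.* x ≡⟨ ℚP.*-zeroˡ x ⟩
    0ℚ ∎
    where open ≡-Reasoning

  Rodd-convolution : ∀ s q → conv (scale q E) E (2 ℕ.* suc s) ≡ Σ (suc s) (λ k → oddCoeff s k ℚ.* qpow q (2 ℕ.* k))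
  Rodd-convolution s q = begin
    conv (scale q E) E N ≡⟨ conv-Σ (scale q E) E N ⟩
    Σ N (λ j → scale q E j ℚ.* E (N ∸ j)) ≡⟨ Σ-even (suc s) _ (λ k → scale-E-odd-term q k (E (N ∸ suc (2 ℕ.* k)))) ⟩
    Σ (suc s) (λ k → scale q E (2 ℕ.* k) ℚ.* E (N ∸ 2 ℕ.* k)) ≡⟨ Σ-cong (suc s) term ⟩
    Σ (suc s) (λ k → oddCoeff s k ℚ.* qpow q (2 ℕ.* k)) ∎
    where
    open ≡-Reasoning
    N = 2 ℕ.* suc s
    term : ∀ k → k ≤ suc s → scale q E (2 ℕ.* k) ℚ.* E (N ∸ 2 ℕ.* k) ≡ oddCoeff s k ℚ.* qpow q (2 ℕ.* k)
    term k _ = begin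
      qpow q (2 ℕ.* k) ℚ.* E (2 ℕ.* k) ℚ.* E (N ∸ 2 ℕ.* k)
        ≡⟨ cong₂ (λ x y → qpow q (2 ℕ.* k) ℚ.* x ℚ.* y) (E-even-coeff-β k)
             (trans (cong E (sym (ℕP.*-distribˡ-∸ 2 (suc s) k))) (trans (E-even-coeff-β (suc s ∸ k)) (cong β (trans (ℕP.*-distribˡ-∸ 2 (suc s) k) (cong (_∸ 2 ℕ.* k) (2[1+s]≡2s+2 s)))))) ⟩
      qpow q (2 ℕ.* k) ℚ.* (B a ℚ.* invFact a) ℚ.* (B b ℚ.* invFact b)
        ≡⟨ solve 5 (λ q x y z w → q :* (x :* y) :* (z :* w) := x :* z :* y :* w :* q) refl (qpow q (2 ℕ.* k)) (B a) (invFact a) (B b) (invFact b) ⟩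
      oddCoeff s k ℚ.* qpow q (2 ℕ.* k) ∎
      where
      a = 2 ℕ.* k
      b = 2 ℕ.* s ℕ.+ 2 ∸ 2 ℕ.* k

  Reven-convolution : ∀ s q → conv (scale q E) O (suc (2 ℕ.* s)) ≡ Σ s (λ k → evenCoeff s k ℚ.* qpow q (2 ℕ.* k))
  Reven-convolution s q = begin
    conv (scale q E) O N ≡⟨ conv-Σ (scale q E) O N ⟩
    Σ N (λ j → scale q E j ℚ.* O (N ∸ j)) ≡⟨ Σ-even-suc s _ (λ k → scale-E-odd-term q k (O (N ∸ suc (2 ℕ.* k)))) ⟩
    Σ s (λ k → scale q E (2 ℕ.* k) ℚ.* O (N ∸ 2 ℕ.* k)) ≡⟨ Σ-cong s term ⟩
    Σ s (λ k → evenCoeff s k ℚ.* qpow q (2 ℕ.* k)) ∎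
    where
    open ≡-Reasoning
    N = suc (2 ℕ.* s)
    term : ∀ k → k ≤ s → scale q E (2 ℕ.* k) ℚ.* O (N ∸ 2 ℕ.* k) ≡ evenCoeff s k ℚ.* qpow q (2 ℕ.* k)
    term k k≤s = begin
      qpow q (2 ℕ.* k) ℚ.* E (2 ℕ.* k) ℚ.* O (N ∸ 2 ℕ.* k)
        ≡⟨ cong (λ z → qpow q (2 ℕ.* k) ℚ.* E (2 ℕ.* k) ℚ.* O z) (1+2s∸2k≡1+2[s∸k] s k k≤s) ⟩
      qpow q (2 ℕ.* k) ℚ.* E (2 ℕ.* k) ℚ.* O (suc (2 ℕ.* (s ∸ k)))
        ≡⟨ solve 3 (λ q e o → q :* e :* o := o :* e :* q) refl (qpow q (2 ℕ.* k)) (E (2 ℕ.* k)) (O (suc (2 ℕ.* (s ∸ k)))) ⟩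
      O (suc (2 ℕ.* (s ∸ k))) ℚ.* E (2 ℕ.* k) ℚ.* qpow q (2 ℕ.* k)
        ≡⟨ cong (ℚ._* qpow q (2 ℕ.* k)) (sym (evenCoeff-OE s k k≤s)) ⟩
      evenCoeff s k ℚ.* qpow q (2 ℕ.* k) ∎

module Values where

  open Scalars
  open FiniteSums
  open PowerSeries
  open SeriesOperators using (scale; scale-1; ≈sym)
  open BernoulliRecursions using (β)
  open GeneratingFunctions using (E; O)
  open Coefficients
  open Evaluation using (oddCoeff; evenCoeff)
  open ProductCoefficients
  open import Data.Rational.Solver
  open +-*-Solver using (solve; _:+_; _:*_; :-_; _:=_; con)

  oddSum : ℕ → ℚ → ℚ
  oddSum s q = Σ (suc s) (λ k → oddCoeff s k ℚ.* qpow q (2 ℕ.* k))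

  evenSum : ℕ → ℚ → ℚ
  evenSum s q = Σ s (λ k → evenCoeff s k ℚ.* qpow q (2 ℕ.* k))

  -- For s = t + 1 the degree 2s + 2 is at least 4, as the coefficient lemmas need.
  2[2+t]≡4+2t : ∀ t → 2 ℕ.* suc (suc t) ≡ suc (suc (suc (suc (2 ℕ.* t))))
  2[2+t]≡4+2t t = trans (ℕP.*-suc 2 (suc t)) (cong (λ z → suc (suc z)) (ℕP.*-suc 2 t))

  oddSum-at-1 : ∀ s → conv E E (2 ℕ.* suc s) ≡ oddSum s 1ℚ
  oddSum-at-1 s = trans (conv-cong {E} {scale 1ℚ E} {E} {E} (≈sym (scale-1 E)) (λ n → refl) (2 ℕ.* suc s)) (Rodd-convolution s 1ℚ)

  evenSum-at-1 : ∀ s → conv E O (suc (2 ℕ.* s)) ≡ evenSum s 1ℚ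
  evenSum-at-1 s = trans (conv-cong {E} {scale 1ℚ E} {O} {O} (≈sym (scale-1 E)) (λ n → refl) (suc (2 ℕ.* s))) (Reven-convolution s 1ℚ)

  Rodd-2≡Rodd-1 : ∀ t → oddSum (suc t) two ≡ oddSum (suc t) 1ℚ
  Rodd-2≡Rodd-1 t = trans (sym (Rodd-convolution (suc t) two)) (trans (subst (λ n → conv (scale two E) E n ≡ conv E E n) (sym (2[2+t]≡4+2t t)) (coeff-E-duplication (suc (2 ℕ.* t)))) (oddSum-at-1 (suc t)))

  Rodd-1-value : ∀ t → let s = suc t in oddSum s 1ℚ ≡ ℚ.- (ℕ→ℚ (2 ℕ.* s ℕ.+ 1) ℚ.* B (2 ℕ.* s ℕ.+ 2) ℚ.* invFact (2 ℕ.* s ℕ.+ 2))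
  Rodd-1-value t = begin
    oddSum s 1ℚ ≡⟨ sym (oddSum-at-1 s) ⟩
    conv E E N ≡⟨ subst (λ n → conv E E n ≡ E n ℚ.+ ℚ.- (ℕ→ℚ n ℚ.* E n)) (sym (2[2+t]≡4+2t t)) (coeff-E² (suc (2 ℕ.* t))) ⟩
    E N ℚ.+ ℚ.- (ℕ→ℚ N ℚ.* E N) ≡⟨ cong (λ n → E n ℚ.+ ℚ.- (ℕ→ℚ n ℚ.* E n)) (2[1+s]≡2s+2 s) ⟩
    E M ℚ.+ ℚ.- (ℕ→ℚ M ℚ.* E M) ≡⟨ cong (λ z → z ℚ.+ ℚ.- (ℕ→ℚ M ℚ.* z)) (trans (cong E (sym (2[1+s]≡2s+2 s))) (trans (E-even-coeff-β s') (cong β (2[1+s]≡2s+2 s)))) ⟩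
    β M ℚ.+ ℚ.- (ℕ→ℚ M ℚ.* β M) ≡⟨ cong (λ z → β M ℚ.+ ℚ.- (z ℚ.* β M)) (trans (cong ℕ→ℚ (sym (ℕP.+-assoc (2 ℕ.* s) 1 1))) (ℕ→ℚ-+ (2 ℕ.* s ℕ.+ 1) 1)) ⟩
    β M ℚ.+ ℚ.- ((ℕ→ℚ (2 ℕ.* s ℕ.+ 1) ℚ.+ 1ℚ) ℚ.* β M) ≡⟨ solve 3 (λ b f c → b :* f :+ :- ((c :+ con 1ℚ) :* (b :* f)) := :- (c :* b :* f)) refl (B M) (invFact M) (ℕ→ℚ (2 ℕ.* s ℕ.+ 1)) ⟩
    ℚ.- (ℕ→ℚ (2 ℕ.* s ℕ.+ 1) ℚ.* B M ℚ.* invFact M) ∎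
    where
    open ≡-Reasoning
    s = suc t
    s' = suc s
    N = 2 ℕ.* suc s
    M = 2 ℕ.* s ℕ.+ 2

  Reven-1-value : ∀ t → let s = suc t in evenSum s 1ℚ ≡ ℚ.- (B* (2 ℕ.* s ℕ.+ 1) ℚ.* invFact (2 ℕ.* s))
  Reven-1-value t = begin
    evenSum s 1ℚ ≡⟨ sym (evenSum-at-1 s) ⟩
    conv E O a' ≡⟨ conv-comm E O a' ⟩
    conv O E a' ≡⟨ subst (λ n → conv O E n ≡ ℚ.- (ℕ→ℚ n ℚ.* O n)) (cong suc (sym (ℕP.*-suc 2 t))) (coeff-OE (suc (2 ℕ.* t))) ⟩
    ℚ.- (ℕ→ℚ a' ℚ.* O a') ≡⟨ cong (λ z → ℚ.- (ℕ→ℚ a' ℚ.* z)) (sym (trans (B*-coeff a') (trans (cong (ℚ._+ O a') (E-odd-coeff s)) (ℚP.+-identityˡ (O a'))))) ⟩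
    ℚ.- (ℕ→ℚ a' ℚ.* (B* a' ℚ.* invFact a')) ≡⟨ cong ℚ.-_ (solve 3 (λ n b f → n :* (b :* f) := b :* (n :* f)) refl (ℕ→ℚ a') (B* a') (invFact a')) ⟩
    ℚ.- (B* a' ℚ.* (ℕ→ℚ a' ℚ.* invFact a')) ≡⟨ cong (λ z → ℚ.- (B* a' ℚ.* z)) (suc*invFact-suc (2 ℕ.* s)) ⟩
    ℚ.- (B* a' ℚ.* invFact (2 ℕ.* s)) ≡⟨ cong (λ z → ℚ.- (B* z ℚ.* invFact (2 ℕ.* s))) (1+2s≡2s+1 s) ⟩
    ℚ.- (B* (2 ℕ.* s ℕ.+ 1) ℚ.* invFact (2 ℕ.* s)) ∎
    where
    open ≡-Reasoning
    s = suc t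
    a' = suc (2 ℕ.* s)

  Rodd-½-value : ∀ t → let s = suc t in oddSum s ½ ≡ twoNeg (2 ℕ.* s ℕ.+ 2) ℚ.* oddSum s 1ℚ
  Rodd-½-value t = begin
    oddSum s ½ ≡⟨ sym (Rodd-convolution s ½) ⟩
    conv (scale ½ E) E N ≡⟨ conv-comm (scale ½ E) E N ⟩
    conv E (scale ½ E) N ≡⟨ subst (λ n → conv E (scale ½ E) n ≡ qpow ½ n ℚ.* conv E E n) (sym (2[2+t]≡4+2t t)) (coeff-E-halving (suc (2 ℕ.* t))) ⟩
    qpow ½ N ℚ.* conv E E N ≡⟨ cong₂ ℚ._*_ (cong (qpow ½) (2[1+s]≡2s+2 s)) (oddSum-at-1 s) ⟩
    twoNeg (2 ℕ.* s ℕ.+ 2) ℚ.* oddSum s 1ℚ ∎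
    where
    open ≡-Reasoning
    s = suc t
    N = 2 ℕ.* suc s

  halfTerm : ℕ → ℕ → ℚ
  halfTerm s k = B* (2 ℕ.* s ℕ.+ 1 ℕ.∸ 2 ℕ.* k) ℚ.* B′ (2 ℕ.* k) ℚ.* invFact (2 ℕ.* s ℕ.+ 1 ℕ.∸ 2 ℕ.* k) ℚ.* invFact (2 ℕ.* k)

  -- R_{2s}(1/2) is the sum of these terms, since B′_{2k}/(2k)! = 2^{-2k}E_{2k}.
  Reven-½-value : ∀ s → evenSum s ½ ≡ Σ s (halfTerm s)
  Reven-½-value s = Σ-cong s term
    where
    term : ∀ k → k ≤ s → evenCoeff s k ℚ.* qpow ½ (2 ℕ.* k) ≡ halfTerm s k
    term k _ = begin
      B* a ℚ.* B* b ℚ.* invFact a ℚ.* invFact b ℚ.* qpow ½ b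
        ≡⟨ solve 5 (λ x y z w q → x :* y :* z :* w :* q := x :* z :* (q :* (y :* w))) refl (B* a) (B* b) (invFact a) (invFact b) (qpow ½ b) ⟩
      B* a ℚ.* invFact a ℚ.* (qpow ½ b ℚ.* (B* b ℚ.* invFact b))
        ≡⟨ cong (λ z → B* a ℚ.* invFact a ℚ.* (qpow ½ b ℚ.* z)) (trans (B*-coeff b) (trans (cong (E b ℚ.+_) (O-even-coeff k)) (ℚP.+-identityʳ (E b)))) ⟩
      B* a ℚ.* invFact a ℚ.* (qpow ½ b ℚ.* E b)
        ≡⟨ cong (λ z → B* a ℚ.* invFact a ℚ.* z) (sym (B′-coeff k)) ⟩
      B* a ℚ.* invFact a ℚ.* (B′ b ℚ.* invFact b)
        ≡⟨ solve 4 (λ x z y w → x :* z :* (y :* w) := x :* y :* z :* w) refl (B* a) (invFact a) (B′ b) (invFact b) ⟩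
      halfTerm s k ∎
      where
      open ≡-Reasoning
      a = 2 ℕ.* s ℕ.+ 1 ℕ.∸ 2 ℕ.* k
      b = 2 ℕ.* k

  Reven-½-vanishes : ∀ t → evenSum (suc t) ½ ≡ 0ℚ
  Reven-½-vanishes t = trans (sym (Reven-convolution s ½)) (trans (conv-comm (scale ½ E) O (suc (2 ℕ.* s)))
    (subst (λ n → conv O (scale ½ E) n ≡ 0ℚ) (cong suc (sym (ℕP.*-suc 2 t))) (coeff-O-halving (suc (2 ℕ.* t)))))
    where s = suc t

  -- R_{2s+1}(i) = 0 when (-1)^s = 1, by the symmetry of the coefficients.
  Rodd-i-vanishes : ∀ s → qpow neg1 s ≡ 1ℚ → Σ (suc s) (λ k → oddCoeff s k ℚ.* qpow neg1 k) ≡ 0ℚ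
  Rodd-i-vanishes s ev = Σ-antisymmetric (suc s) _ (λ k k≤ → trans (cong₂ ℚ._*_ (oddCoeff-symmetric s k k≤)
      (neg1^-flip (suc s ∸ k) k (trans (cong (qpow neg1) (ℕP.m∸n+n≡m k≤)) (neg1^-suc s ev))))
    (solve 2 (λ c m → c :* (:- m) := :- (c :* m)) refl (oddCoeff s k) (qpow neg1 k)))

  -- The difference between R_{2s}(i) and R_{2s}(i/2), term by term, via
  -- E(t) - E(t/2) = (t/4)·O(t).
  crossTerm : ℕ → ℕ → ℚ
  crossTerm t j = qpow neg1 (suc j) ℚ.* O (suc (2 ℕ.* (t ∸ j))) ℚ.* (¼ ℚ.* O (suc (2 ℕ.* j)))

  crossTerm-antisymmetric : ∀ t → qpow neg1 (suc t) ≡ 1ℚ → Σ t (crossTerm t) ≡ 0ℚ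
  crossTerm-antisymmetric t ev = Σ-antisymmetric t (crossTerm t) (λ j j≤ → begin
    qpow neg1 (suc (t ∸ j)) ℚ.* O (suc (2 ℕ.* (t ∸ (t ∸ j)))) ℚ.* (¼ ℚ.* O (suc (2 ℕ.* (t ∸ j))))
      ≡⟨ cong₂ (λ x y → x ℚ.* O (suc (2 ℕ.* y)) ℚ.* (¼ ℚ.* O (suc (2 ℕ.* (t ∸ j)))))
           (neg1^-flip (suc (t ∸ j)) (suc j) (trans (cong (λ z → qpow neg1 (suc z)) (trans (ℕP.+-suc (t ∸ j) j) (cong suc (ℕP.m∸n+n≡m j≤)))) (neg1^-suc (suc t) ev)))
           (ℕP.m∸[m∸n]≡n j≤) ⟩
    ℚ.- qpow neg1 (suc j) ℚ.* O (suc (2 ℕ.* j)) ℚ.* (¼ ℚ.* O (suc (2 ℕ.* (t ∸ j))))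
      ≡⟨ solve 4 (λ m x q y → :- m :* x :* (q :* y) := :- (m :* y :* (q :* x))) refl (qpow neg1 (suc j)) (O (suc (2 ℕ.* j))) ¼ (O (suc (2 ℕ.* (t ∸ j)))) ⟩
    ℚ.- crossTerm t j ∎)
    where open ≡-Reasoning

  -¼ : ℚ
  -¼ = ℚ.- (½ ℚ.* ½)

  -¼^ : ∀ n → qpow -¼ n ≡ qpow neg1 n ℚ.* qpow ½ (2 ℕ.* n)
  -¼^ n = sym (trans (cong (qpow neg1 n ℚ.*_) (qpow-double ½ n)) (qpow-* neg1 (½ ℚ.* ½) n))

  Reven-i≡Reven-i/2 : ∀ t → qpow neg1 (suc t) ≡ 1ℚ → Σ (suc t) (λ k → evenCoeff (suc t) k ℚ.* qpow neg1 k) ≡ Σ (suc t) (λ k → evenCoeff (suc t) k ℚ.* qpow -¼ k)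
  Reven-i≡Reven-i/2 t ev = diff-zero-ℚ _ _ (begin
    Σ s f ℚ.+ ℚ.- Σ s g ≡⟨ cong (Σ s f ℚ.+_) (sym (Σ-neg s g)) ⟩
    Σ s f ℚ.+ Σ s (λ k → ℚ.- g k) ≡⟨ sym (Σ-+ s f (λ k → ℚ.- g k)) ⟩
    Σ s D ≡⟨ Σ-front t D ⟩
    D 0 ℚ.+ Σ t (λ j → D (suc j)) ≡⟨ cong₂ ℚ._+_ (solve 1 (λ c → c :* con 1ℚ :+ :- (c :* con 1ℚ) := con 0ℚ) refl (evenCoeff s 0)) (Σ-cong t term) ⟩
    0ℚ ℚ.+ Σ t (crossTerm t) ≡⟨ trans (ℚP.+-identityˡ _) (crossTerm-antisymmetric t ev) ⟩
    0ℚ ∎)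
    where
    open ≡-Reasoning
    s = suc t
    f g D : ℕ → ℚ
    f k = evenCoeff s k ℚ.* qpow neg1 k
    g k = evenCoeff s k ℚ.* qpow -¼ k
    D k = f k ℚ.+ ℚ.- g k
    term : ∀ j → j ≤ t → D (suc j) ≡ crossTerm t j
    term j j≤ = begin
      evenCoeff s (suc j) ℚ.* qpow neg1 (suc j) ℚ.+ ℚ.- (evenCoeff s (suc j) ℚ.* qpow -¼ (suc j))
        ≡⟨ cong₂ (λ x y → x ℚ.* qpow neg1 (suc j) ℚ.+ ℚ.- (x ℚ.* y)) (evenCoeff-OE s (suc j) (s≤s j≤)) (-¼^ (suc j)) ⟩
      o ℚ.* e ℚ.* m ℚ.+ ℚ.- (o ℚ.* e ℚ.* (m ℚ.* q))
        ≡⟨ solve 4 (λ o e m q → o :* e :* m :+ :- (o :* e :* (m :* q)) := m :* o :* (e :+ :- (q :* e))) refl o e m q ⟩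
      m ℚ.* o ℚ.* (e ℚ.+ ℚ.- (q ℚ.* e))
        ≡⟨ cong (m ℚ.* o ℚ.*_) (subst (λ n → E n ℚ.+ ℚ.- (qpow ½ n ℚ.* E n) ≡ ¼ ℚ.* O (suc (2 ℕ.* j))) (sym (ℕP.*-suc 2 j)) (coeff-E-halving-O (suc (2 ℕ.* j)))) ⟩
      crossTerm t j ∎
      where
      o = O (suc (2 ℕ.* (t ∸ j)))
      e = E (2 ℕ.* suc j)
      m = qpow neg1 (suc j)
      q = qpow ½ (2 ℕ.* suc j)

open import Data.Nat.Divisibility using (_∣_; divides)
open import Data.Product using (_×_; _,_)
open Scalars using (two; neg1; neg1^even)
open Evaluation using (ι-*; Rodd-real; Reven-real; Rodd-imaginary; Reven-imaginary)
open Values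

corollary1 : (s : ℕ) → 1 ≤ s →
    (Rodd s (ι (+ 2 / 1)) ≡ Rodd s (ι 1ℚ))
    × (Rodd s (ι 1ℚ) ≡ ι (ℚ.- (ℕ→ℚ (2 ℕ.* s ℕ.+ 1) ℚ.* B (2 ℕ.* s ℕ.+ 2) ℚ.* invFact (2 ℕ.* s ℕ.+ 2))))
    × (Reven s (ι 1ℚ) ≡ ι (ℚ.- (B* (2 ℕ.* s ℕ.+ 1) ℚ.* invFact (2 ℕ.* s))))
    × (Rodd s (ι ½) ≡ ι (twoNeg (2 ℕ.* s ℕ.+ 2)) ⊗ Rodd s (ι 1ℚ))
    × (Reven s (ι ½) ≡ ι (sumTo ℚ._+_ s (λ k → B* (2 ℕ.* s ℕ.+ 1 ℕ.∸ 2 ℕ.* k) ℚ.* B′ (2 ℕ.* k) ℚ.* invFact (2 ℕ.* s ℕ.+ 1 ℕ.∸ 2 ℕ.* k) ℚ.* invFact (2 ℕ.* k))))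
    × (sumTo ℚ._+_ s (λ k → B* (2 ℕ.* s ℕ.+ 1 ℕ.∸ 2 ℕ.* k) ℚ.* B′ (2 ℕ.* k) ℚ.* invFact (2 ℕ.* s ℕ.+ 1 ℕ.∸ 2 ℕ.* k) ℚ.* invFact (2 ℕ.* k)) ≡ 0ℚ)
    × (2 ∣ s → (Rodd s 𝕚 ≡ ι 0ℚ) × (Reven s 𝕚 ≡ Reven s (ι ½ ⊗ 𝕚)))
corollary1 s@(suc t) (s≤s z≤n) =
    trans (Rodd-real s two) (trans (cong ι (Rodd-2≡Rodd-1 t)) (sym (Rodd-real s 1ℚ)))
  , trans (Rodd-real s 1ℚ) (cong ι (Rodd-1-value t))
  , trans (Reven-real s 1ℚ) (cong ι (Reven-1-value t))
  , trans (Rodd-real s ½) (trans (cong ι (Rodd-½-value t))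
      (trans (sym (ι-* (twoNeg (2 ℕ.* s ℕ.+ 2)) (oddSum s 1ℚ))) (cong (ι (twoNeg (2 ℕ.* s ℕ.+ 2)) ⊗_) (sym (Rodd-real s 1ℚ)))))
  , trans (Reven-real s ½) (cong ι (Reven-½-value s))
  , trans (sym (Reven-½-value s)) (Reven-½-vanishes t)
  , λ { (divides q s≡q*2) → let even = sign-even q s≡q*2 in
        trans (Rodd-imaginary s 1ℚ) (cong ι (Rodd-i-vanishes s even))
      , trans (Reven-imaginary s 1ℚ) (trans (cong ι (Reven-i≡Reven-i/2 t even)) (sym (Reven-imaginary s ½))) }
  where
  sign-even : ∀ q → s ≡ q ℕ.* 2 → qpow neg1 s ≡ 1ℚ
  sign-even q eq = trans (cong (qpow neg1) (trans eq (ℕP.*-comm q 2))) (neg1^even q)
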